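{- Let $v\in\mathrm{Val}(\forall\alpha.\alpha\times\alpha\to\alpha)$. Suppose that $v[\tau]$ must-converges for every closed type $\tau$, and that there exist a closed type $\tau$ and $u\in\mathrm{Val}(\tau\times\tau)$ such that $(\lambda x.\,x\,u)(v[\tau])$ may-diverges. Then for every closed type $\tau'$ and every $u'\in\mathrm{Val}(\tau'\times\tau')$, $\emptyset;\emptyset\vdash(\lambda x.\,x\,u')(v[\tau'])\cong^{ctx}_{\Downarrow}\Omega[\tau']:\tau'$.
   Context: Language. Types: $\tau ::= \alpha \mid \mathbf{1} \mid \tau_1\times\tau_2 \mid \tau_1\to\tau_2 \mid \mu\alpha.(\tau_1+\dots+\tau_n) \mid \forall\alpha.\tau$. Values: $v ::= x \mid \langle\rangle \mid \langle v_1,v_2\rangle \mid \lambda x.e \mid \mathsf{in}_i\,v \mid \Lambda\alpha.e$. Terms: $e ::= v \mid ? \mid \mathsf{proj}_i\,v \mid v\,e \mid \mathsf{case}\,v\,\mathsf{of}\,(\mathsf{in}_1 x_1\Rightarrow e_1\mid\dots\mid \mathsf{in}_n x_n\Rightarrow e_n) \mid v[\tau]$. Evaluation contexts $E ::= [\,]\mid v\,E$. Reduction $\mapsto$: $\mathsf{proj}_i\langle v_1,v_2\rangle\mapsto v_i$; $(\lambda x.e)\,v\mapsto e[v/x]$; $(\Lambda\alpha.e)[\tau]\mapsto e[\tau/\alpha]$; $\mathsf{case}\,(\mathsf{in}_j v)\,\mathsf{of}(\dots\mid\mathsf{in}_j x_j\Rightarrow e_j\mid\dots)\mapsto e_j[v/x_j]$;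 $?\mapsto\underline n$ for each $n\in\mathbb N$ ($\mathsf{nat}=\mu\alpha.(\mathbf 1+\alpha)$, $\underline 0=\mathsf{in}_1\langle\rangle$, $\underline{n+1}=\mathsf{in}_2\underline n$); $v\,e\mapsto v\,e'$ if $e\mapsto e'$. Typing is standard for this call-by-value polymorphic lambda calculus with iso-recursive sums and $?:\mathsf{nat}$; $\mathrm{Val}(\tau)$ = closed values of closed type $\tau$. $e$ may-diverges if there is an infinite reduction sequence from $e$; $e\Downarrow$ (must-converges) if it does not may-diverge. $\Omega$ denotes the closed value $\Lambda\alpha.\,\mathsf{fix}[\mathbf 1][\alpha]\,(\lambda f.f)\,\langle\rangle$ of type $\forall\alpha.\alpha$, where $\mathsf{fix}=\Lambda\alpha.\Lambda\beta.\lambda f.\,\delta_f\,(\mathsf{in}\,\delta_f)$, $\delta_f=\lambda y.\,\mathsf{case}\,y\,\mathsf{of}\,(\mathsf{in}\,y'\Rightarrow f(\lambda x.\,(\lambda r.r\,x)(y'\,y)))$ with $\mathsf{in}$ the injection into $\mu\gamma.(\gamma\to(\alpha\to\beta))$; for every closed $\tau$, reduction of $\Omega[\tau]$ is deterministic and non-terminating. A type-indexed relation is a set of tuples $(\Delta,\Gamma,e,e',\tau)$ with $e,e'$ both of type $\tau$ in $\Delta;\Gamma$; compatible if it relates each variable to itself, $\langle\rangle$ to $\langle\rangle$, $?$ to $?$, and terms built by the same constructor from related immediate subterms; a precongruence is reflexive, transitive and compatible; must-adequate if whenever it relates closed $e,e'$, $e\Downarrow\Rightarrow e'\Downarrow$.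 $\lesssim^{ctx}_{\Downarrow}$ is the largest must-adequate precongruence and $\cong^{ctx}_{\Downarrow}$ its symmetrization. -}

module Defs where

open import Data.Nat using (ℕ; zero; suc; _<_)
open import Data.Fin using (Fin; toℕ)
open import Data.Vec using (Vec; []; _∷_; lookup)
open import Data.List using (List; []; _∷_; map)
open import Data.Product using (Σ; _×_; _,_)
open import Relation.Nullary using (¬_)
open import Relation.Binary.PropositionalEquality using (_≡_)

-- Types (de Bruijn indices for type variables)
--   tv x      : type variable
--   𝟙         : unit type
--   τ₁ ⊗ τ₂   : product
--   τ₁ ⇒ τ₂   : function
--   μ ts      : μα.(τ₁ + … + τₙ), n ≥ 1; α is bound (index 0) in each τᵢ
--   ∀ᵗ τ      : ∀α.τ, α is index 0 in τ

data Ty : Set where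
  tv  : ℕ → Ty
  𝟙   : Ty
  _⊗_ : Ty → Ty → Ty
  _⇒_ : Ty → Ty → Ty
  μ   : ∀ {n} → Vec Ty (suc n) → Ty
  ∀ᵗ  : Ty → Ty

infixr 6 _⊗_
infixr 5 _⇒_

ext : (ℕ → ℕ) → ℕ → ℕ
ext ρ zero    = zero
ext ρ (suc x) = suc (ρ x)

mutual
  renTy : (ℕ → ℕ) → Ty → Ty
  renTy ρ (tv x)    = tv (ρ x)
  renTy ρ 𝟙         = 𝟙
  renTy ρ (a ⊗ b)   = renTy ρ a ⊗ renTy ρ b
  renTy ρ (a ⇒ b)   = renTy ρ a ⇒ renTy ρ b
  renTy ρ (μ ts)    = μ (renTys (ext ρ) ts)
  renTy ρ (∀ᵗ a)    = ∀ᵗ (renTy (ext ρ) a)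

  renTys : ∀ {n} → (ℕ → ℕ) → Vec Ty n → Vec Ty n
  renTys ρ []       = []
  renTys ρ (t ∷ ts) = renTy ρ t ∷ renTys ρ ts

extsTy : (ℕ → Ty) → ℕ → Ty
extsTy σ zero    = tv zero
extsTy σ (suc x) = renTy suc (σ x)

mutual
  subTy : (ℕ → Ty) → Ty → Ty
  subTy σ (tv x)    = σ x
  subTy σ 𝟙         = 𝟙
  subTy σ (a ⊗ b)   = subTy σ a ⊗ subTy σ b
  subTy σ (a ⇒ b)   = subTy σ a ⇒ subTy σ b
  subTy σ (μ ts)    = μ (subTys (extsTy σ) ts)
  subTy σ (∀ᵗ a)    = ∀ᵗ (subTy (extsTy σ) a)

  subTys : ∀ {n} → (ℕ → Ty) → Vec Ty n → Vec Ty n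
  subTys σ []       = []
  subTys σ (t ∷ ts) = subTy σ t ∷ subTys σ ts

_[_]ᵗ : Ty → Ty → Ty
τ [ σ ]ᵗ = subTy (λ { zero → σ ; (suc x) → tv x }) τ

data WF (Δ : ℕ) : Ty → Set where
  wf-tv : ∀ {x} → x < Δ → WF Δ (tv x)
  wf-𝟙  : WF Δ 𝟙
  wf-⊗  : ∀ {a b} → WF Δ a → WF Δ b → WF Δ (a ⊗ b)
  wf-⇒  : ∀ {a b} → WF Δ a → WF Δ b → WF Δ (a ⇒ b)
  wf-μ  : ∀ {n} {ts : Vec Ty (suc n)} →
          (∀ i → WF (suc Δ) (lookup ts i)) → WF Δ (μ ts)
  wf-∀  : ∀ {a} → WF (suc Δ) a → WF Δ (∀ᵗ a)

Closed : Ty → Set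
Closed τ = WF 0 τ

nat : Ty
nat = μ (𝟙 ∷ tv zero ∷ [])

-- Values and terms (A-normal form; de Bruijn indices for term variables)
-- Injection / case indices are 0-based: inj 0 is the paper's in₁.

mutual
  data Val : Set where
    var   : ℕ → Val
    ⟨⟩    : Val
    ⟨_,_⟩ : Val → Val → Val
    ƛ     : Tm → Val
    inj   : ℕ → Val → Val
    Λ     : Tm → Val

  data Tm : Set where
    val  : Val → Tm
    ？    : Tm
    fst  : Val → Tm
    snd  : Val → Tm
    _·_  : Val → Tm → Tm
    case : ∀ {n} → Val → Vec Tm (suc n) → Tm   -- each branch binds index 0
    tapp : Val → Ty → Tm

infixl 7 _·_

mutual
  renTyV : (ℕ → ℕ) → Val → Val
  renTyV ρ (var x)     = var x
  renTyV ρ ⟨⟩          = ⟨⟩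
  renTyV ρ ⟨ a , b ⟩   = ⟨ renTyV ρ a , renTyV ρ b ⟩
  renTyV ρ (ƛ e)       = ƛ (renTyT ρ e)
  renTyV ρ (inj i v)   = inj i (renTyV ρ v)
  renTyV ρ (Λ e)       = Λ (renTyT (ext ρ) e)

  renTyT : (ℕ → ℕ) → Tm → Tm
  renTyT ρ (val v)     = val (renTyV ρ v)
  renTyT ρ ？          = ？
  renTyT ρ (fst v)     = fst (renTyV ρ v)
  renTyT ρ (snd v)     = snd (renTyV ρ v)
  renTyT ρ (v · e)     = renTyV ρ v · renTyT ρ e
  renTyT ρ (case v bs) = case (renTyV ρ v) (renTyTs ρ bs)
  renTyT ρ (tapp v τ)  = tapp (renTyV ρ v) (renTy ρ τ)

  renTyTs : ∀ {n} → (ℕ → ℕ) → Vec Tm n → Vec Tm n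
  renTyTs ρ []       = []
  renTyTs ρ (e ∷ es) = renTyT ρ e ∷ renTyTs ρ es

mutual
  subTyV : (ℕ → Ty) → Val → Val
  subTyV σ (var x)     = var x
  subTyV σ ⟨⟩          = ⟨⟩
  subTyV σ ⟨ a , b ⟩   = ⟨ subTyV σ a , subTyV σ b ⟩
  subTyV σ (ƛ e)       = ƛ (subTyT σ e)
  subTyV σ (inj i v)   = inj i (subTyV σ v)
  subTyV σ (Λ e)       = Λ (subTyT (extsTy σ) e)

  subTyT : (ℕ → Ty) → Tm → Tm
  subTyT σ (val v)     = val (subTyV σ v)
  subTyT σ ？          = ？
  subTyT σ (fst v)     = fst (subTyV σ v)
  subTyT σ (snd v)     = snd (subTyV σ v)
  subTyT σ (v · e)     = subTyV σ v · subTyT σ e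
  subTyT σ (case v bs) = case (subTyV σ v) (subTyTs σ bs)
  subTyT σ (tapp v τ)  = tapp (subTyV σ v) (subTy σ τ)

  subTyTs : ∀ {n} → (ℕ → Ty) → Vec Tm n → Vec Tm n
  subTyTs σ []       = []
  subTyTs σ (e ∷ es) = subTyT σ e ∷ subTyTs σ es

_[_]ᵀ : Tm → Ty → Tm
e [ τ ]ᵀ = subTyT (λ { zero → τ ; (suc x) → tv x }) e

mutual
  renV : (ℕ → ℕ) → Val → Val
  renV ρ (var x)     = var (ρ x)
  renV ρ ⟨⟩          = ⟨⟩
  renV ρ ⟨ a , b ⟩   = ⟨ renV ρ a , renV ρ b ⟩
  renV ρ (ƛ e)       = ƛ (renT (ext ρ) e)
  renV ρ (inj i v)   = inj i (renV ρ v)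
  renV ρ (Λ e)       = Λ (renT ρ e)

  renT : (ℕ → ℕ) → Tm → Tm
  renT ρ (val v)     = val (renV ρ v)
  renT ρ ？          = ？
  renT ρ (fst v)     = fst (renV ρ v)
  renT ρ (snd v)     = snd (renV ρ v)
  renT ρ (v · e)     = renV ρ v · renT ρ e
  renT ρ (case v bs) = case (renV ρ v) (renTs (ext ρ) bs)
  renT ρ (tapp v τ)  = tapp (renV ρ v) τ

  renTs : ∀ {n} → (ℕ → ℕ) → Vec Tm n → Vec Tm n
  renTs ρ []       = []
  renTs ρ (e ∷ es) = renT ρ e ∷ renTs ρ es

extsV : (ℕ → Val) → ℕ → Val
extsV σ zero    = var zero
extsV σ (suc x) = renV suc (σ x)

mutual
  subV : (ℕ → Val) → Val → Val
  subV σ (var x)     = σ x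
  subV σ ⟨⟩          = ⟨⟩
  subV σ ⟨ a , b ⟩   = ⟨ subV σ a , subV σ b ⟩
  subV σ (ƛ e)       = ƛ (subT (extsV σ) e)
  subV σ (inj i v)   = inj i (subV σ v)
  subV σ (Λ e)       = Λ (subT (λ x → renTyV suc (σ x)) e)

  subT : (ℕ → Val) → Tm → Tm
  subT σ (val v)     = val (subV σ v)
  subT σ ？          = ？
  subT σ (fst v)     = fst (subV σ v)
  subT σ (snd v)     = snd (subV σ v)
  subT σ (v · e)     = subV σ v · subT σ e
  subT σ (case v bs) = case (subV σ v) (subTs (extsV σ) bs)
  subT σ (tapp v τ)  = tapp (subV σ v) τ

  subTs : ∀ {n} → (ℕ → Val) → Vec Tm n → Vec Tm n
  subTs σ []       = []
  subTs σ (e ∷ es) = subT σ e ∷ subTs σ es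

_[_]ᵉ : Tm → Val → Tm
e [ v ]ᵉ = subT (λ { zero → v ; (suc x) → var x }) e

num : ℕ → Val
num zero    = inj 0 ⟨⟩
num (suc n) = inj 1 (num n)

infix 4 _⟶_
data _⟶_ : Tm → Tm → Set where
  β-fst  : ∀ {v₁ v₂} → fst ⟨ v₁ , v₂ ⟩ ⟶ val v₁
  β-snd  : ∀ {v₁ v₂} → snd ⟨ v₁ , v₂ ⟩ ⟶ val v₂
  β-ƛ    : ∀ {e v} → ƛ e · val v ⟶ e [ v ]ᵉ
  β-Λ    : ∀ {e τ} → tapp (Λ e) τ ⟶ e [ τ ]ᵀ
  β-case : ∀ {n v} {bs : Vec Tm (suc n)} (j : Fin (suc n)) →
           case (inj (toℕ j) v) bs ⟶ lookup bs j [ v ]ᵉ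
  β-？    : ∀ n → ？ ⟶ val (num n)
  ξ-app  : ∀ {v e e'} → e ⟶ e' → v · e ⟶ v · e'

MayDiverge : Tm → Set
MayDiverge e = Σ (ℕ → Tm) λ f → (f 0 ≡ e) × (∀ n → f n ⟶ f (suc n))

_⇓ : Tm → Set
e ⇓ = ¬ MayDiverge e

Ctx : Set
Ctx = List Ty

data _∋_∶_ : Ctx → ℕ → Ty → Set where
  here  : ∀ {Γ τ} → (τ ∷ Γ) ∋ zero ∶ τ
  there : ∀ {Γ x τ σ} → Γ ∋ x ∶ τ → (σ ∷ Γ) ∋ suc x ∶ τ

infix 3 _⨾_⊢_∶_
data _⨾_⊢_∶_ : ℕ → Ctx → Tm → Ty → Set where
  ⊢var  : ∀ {Δ Γ x τ} → Γ ∋ x ∶ τ → Δ ⨾ Γ ⊢ val (var x) ∶ τ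
  ⊢⟨⟩   : ∀ {Δ Γ} → Δ ⨾ Γ ⊢ val ⟨⟩ ∶ 𝟙
  ⊢pair : ∀ {Δ Γ v₁ v₂ τ₁ τ₂} →
          Δ ⨾ Γ ⊢ val v₁ ∶ τ₁ → Δ ⨾ Γ ⊢ val v₂ ∶ τ₂ →
          Δ ⨾ Γ ⊢ val ⟨ v₁ , v₂ ⟩ ∶ τ₁ ⊗ τ₂
  ⊢ƛ    : ∀ {Δ Γ e τ₁ τ₂} → WF Δ τ₁ →
          Δ ⨾ (τ₁ ∷ Γ) ⊢ e ∶ τ₂ → Δ ⨾ Γ ⊢ val (ƛ e) ∶ τ₁ ⇒ τ₂
  ⊢inj  : ∀ {Δ Γ n v} {ts : Vec Ty (suc n)} → WF Δ (μ ts) → (i : Fin (suc n)) →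
          Δ ⨾ Γ ⊢ val v ∶ lookup ts i [ μ ts ]ᵗ →
          Δ ⨾ Γ ⊢ val (inj (toℕ i) v) ∶ μ ts
  ⊢Λ    : ∀ {Δ Γ e τ} → suc Δ ⨾ map (renTy suc) Γ ⊢ e ∶ τ →
          Δ ⨾ Γ ⊢ val (Λ e) ∶ ∀ᵗ τ
  ⊢？    : ∀ {Δ Γ} → Δ ⨾ Γ ⊢ ？ ∶ nat
  ⊢fst  : ∀ {Δ Γ v τ₁ τ₂} → Δ ⨾ Γ ⊢ val v ∶ τ₁ ⊗ τ₂ → Δ ⨾ Γ ⊢ fst v ∶ τ₁
  ⊢snd  : ∀ {Δ Γ v τ₁ τ₂} → Δ ⨾ Γ ⊢ val v ∶ τ₁ ⊗ τ₂ → Δ ⨾ Γ ⊢ snd v ∶ τ₂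
  ⊢app  : ∀ {Δ Γ v e τ₁ τ₂} → Δ ⨾ Γ ⊢ val v ∶ τ₁ ⇒ τ₂ → Δ ⨾ Γ ⊢ e ∶ τ₁ →
          Δ ⨾ Γ ⊢ v · e ∶ τ₂
  ⊢case : ∀ {Δ Γ n v τ} {ts : Vec Ty (suc n)} {bs : Vec Tm (suc n)} →
          Δ ⨾ Γ ⊢ val v ∶ μ ts →
          (∀ i → Δ ⨾ (lookup ts i [ μ ts ]ᵗ ∷ Γ) ⊢ lookup bs i ∶ τ) →
          Δ ⨾ Γ ⊢ case v bs ∶ τ
  ⊢tapp : ∀ {Δ Γ v τ σ} → Δ ⨾ Γ ⊢ val v ∶ ∀ᵗ τ → WF Δ σ →
          Δ ⨾ Γ ⊢ tapp v σ ∶ τ [ σ ]ᵗ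

IsVal : Ty → Val → Set
IsVal τ v = 0 ⨾ [] ⊢ val v ∶ τ

TRel : Set₁
TRel = ℕ → Ctx → Tm → Tm → Ty → Set

TypeIndexed : TRel → Set
TypeIndexed R = ∀ {Δ Γ e e' τ} → R Δ Γ e e' τ →
                (Δ ⨾ Γ ⊢ e ∶ τ) × (Δ ⨾ Γ ⊢ e' ∶ τ)

Reflexive : TRel → Set
Reflexive R = ∀ {Δ Γ e τ} → Δ ⨾ Γ ⊢ e ∶ τ → R Δ Γ e e τ

Transitive : TRel → Set
Transitive R = ∀ {Δ Γ e e' e'' τ} → R Δ Γ e e' τ → R Δ Γ e' e'' τ → R Δ Γ e e'' τ

record Compatible (R : TRel) : Set where
  field
    c-var  : ∀ {Δ Γ x τ} → Γ ∋ x ∶ τ → R Δ Γ (val (var x)) (val (var x)) τ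
    c-⟨⟩   : ∀ {Δ Γ} → R Δ Γ (val ⟨⟩) (val ⟨⟩) 𝟙
    c-？    : ∀ {Δ Γ} → R Δ Γ ？ ？ nat
    c-pair : ∀ {Δ Γ v₁ v₁' v₂ v₂' τ₁ τ₂} →
             R Δ Γ (val v₁) (val v₁') τ₁ → R Δ Γ (val v₂) (val v₂') τ₂ →
             R Δ Γ (val ⟨ v₁ , v₂ ⟩) (val ⟨ v₁' , v₂' ⟩) (τ₁ ⊗ τ₂)
    c-ƛ    : ∀ {Δ Γ e e' τ₁ τ₂} → WF Δ τ₁ → R Δ (τ₁ ∷ Γ) e e' τ₂ →
             R Δ Γ (val (ƛ e)) (val (ƛ e')) (τ₁ ⇒ τ₂)
    c-inj  : ∀ {Δ Γ n v v'} {ts : Vec Ty (suc n)} → WF Δ (μ ts) → (i : Fin (suc n)) →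
             R Δ Γ (val v) (val v') (lookup ts i [ μ ts ]ᵗ) →
             R Δ Γ (val (inj (toℕ i) v)) (val (inj (toℕ i) v')) (μ ts)
    c-Λ    : ∀ {Δ Γ e e' τ} → R (suc Δ) (map (renTy suc) Γ) e e' τ →
             R Δ Γ (val (Λ e)) (val (Λ e')) (∀ᵗ τ)
    c-fst  : ∀ {Δ Γ v v' τ₁ τ₂} → R Δ Γ (val v) (val v') (τ₁ ⊗ τ₂) →
             R Δ Γ (fst v) (fst v') τ₁
    c-snd  : ∀ {Δ Γ v v' τ₁ τ₂} → R Δ Γ (val v) (val v') (τ₁ ⊗ τ₂) →
             R Δ Γ (snd v) (snd v') τ₂
    c-app  : ∀ {Δ Γ v v' e e' τ₁ τ₂} → R Δ Γ (val v) (val v') (τ₁ ⇒ τ₂) →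
             R Δ Γ e e' τ₁ → R Δ Γ (v · e) (v' · e') τ₂
    c-case : ∀ {Δ Γ n v v' τ} {ts : Vec Ty (suc n)} {bs bs' : Vec Tm (suc n)} →
             R Δ Γ (val v) (val v') (μ ts) →
             (∀ i → R Δ (lookup ts i [ μ ts ]ᵗ ∷ Γ) (lookup bs i) (lookup bs' i) τ) →
             R Δ Γ (case v bs) (case v' bs') τ
    c-tapp : ∀ {Δ Γ v v' τ σ} → R Δ Γ (val v) (val v') (∀ᵗ τ) → WF Δ σ →
             R Δ Γ (tapp v σ) (tapp v' σ) (τ [ σ ]ᵗ)

Precongruence : TRel → Set
Precongruence R = Reflexive R × Transitive R × Compatible R

MustAdequate : TRel → Set
MustAdequate R = ∀ {e e' τ} → R 0 [] e e' τ → e ⇓ → e' ⇓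

-- ≲ctx⇓ : the largest must-adequate precongruence, i.e. the union of all
-- must-adequate precongruences (which is itself one).
_⨾_⊢_≲ctx_∶_ : ℕ → Ctx → Tm → Tm → Ty → Set₁
Δ ⨾ Γ ⊢ e ≲ctx e' ∶ τ =
  Σ TRel λ R → TypeIndexed R × Precongruence R × MustAdequate R × R Δ Γ e e' τ

_⨾_⊢_≅ctx_∶_ : ℕ → Ctx → Tm → Tm → Ty → Set₁
Δ ⨾ Γ ⊢ e ≅ctx e' ∶ τ = (Δ ⨾ Γ ⊢ e ≲ctx e' ∶ τ) × (Δ ⨾ Γ ⊢ e' ≲ctx e ∶ τ)

-- fix and Ω
--   fix = Λα.Λβ.λf. δ_f (in δ_f)
--   δ_f = λy. case y of (in y' ⇒ f (λx. (λr. r x) (y' y)))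

fix : Val
fix = Λ (val (Λ (val (ƛ (δ · val (inj 0 δ))))))
  where
    -- context: f = 0
    δ : Val
    δ = ƛ (case (var 0)
              ((var 2 · val (ƛ (ƛ (var 0 · val (var 1)) · (var 1 · val (var 2))))) ∷ []))
    -- in the branch: y' = 0, y = 1, f = 2;
    -- under λx: x = 0, y' = 1, y = 2, f = 3; under λr: r = 0, x = 1

-- Ω = Λα. fix[𝟙][α] (λf.f) ⟨⟩, with the nested applications written in
-- A-normal form via let x = e₁ in e₂ ≡ (λx.e₂) e₁ (left to right):
--   let a = fix[𝟙] in let b = a[α] in let c = b (λf.f) in c ⟨⟩
Ω : Val
Ω = Λ (ƛ (ƛ (ƛ (var 0 · val ⟨⟩) · (var 0 · val (ƛ (val (var 0)))))
             · tapp (var 0) (tv 0))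
        · tapp fix 𝟙)

-- (1) Uniformity (parametricity).  All such terms are instances of the open
--     term G = (λx. x ⟨y₁ , y₂⟩)(v[α]) with y₁ y₂ : α.  A simulation relates
--     an open term to its instances; steps of an instance are matched by G
--     (which cannot be stuck on the abstractly typed y₁, y₂) and steps of G
--     by every instance, so divergence passes from one instance to all.
-- (2) A diverging closed term is below every term of its type: closing
--     "divergent ≤ anything" under term formers and transitivity gives a
--     precongruence, must-adequate by the same simulation technique.
-- As Ω[τ'] diverges, (1) and (2) give both directions.
module Submission where

open import Defs
open import Data.Empty using (⊥; ⊥-elim)
open import Data.Fin using (Fin; toℕ; zero; suc)
open import Data.Fin.Properties using (toℕ-injective)
open import Data.List using ([]; _∷_; map; length)
open import Data.List.Properties using (length-map; map-cong; map-∘; map-id)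
open import Data.Maybe using (Maybe; just; nothing)
open import Data.Nat using (ℕ; zero; suc; _<_; z<s; s<s)
open import Data.Product using (Σ; _×_; _,_; proj₁; proj₂)
open import Data.Sum using (_⊎_; inj₁; inj₂)
open import Data.Vec using (Vec; []; _∷_; lookup)
open import Data.Vec.Relation.Binary.Pointwise.Extensional using (Pointwise-≡⇒≡) renaming (ext to pointwise)
open import Function using (_∘_)
open import Relation.Binary.Construct.Closure.ReflexiveTransitive using (Star; ε; _◅_; _◅◅_; gmap)
open import Relation.Binary.PropositionalEquality using (_≡_; refl; sym; trans; cong; cong₂; subst; subst₂; module ≡-Reasoning)
open import Relation.Nullary using (¬_)

vec-ext : ∀ {A : Set} {n} {xs ys : Vec A n} → (∀ i → lookup xs i ≡ lookup ys i) → xs ≡ ys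
vec-ext h = Pointwise-≡⇒≡ (pointwise h)

-- Every fusion law is
-- stated for maps agreeing pointwise with the intended composite: that is
-- the form of the hypothesis which survives passing under a binder.

ext-fusion : ∀ {ρ ρ' ρ''} → (∀ x → ρ (ρ' x) ≡ ρ'' x) → ∀ x → ext ρ (ext ρ' x) ≡ ext ρ'' x
ext-fusion h zero    = refl
ext-fusion h (suc x) = cong suc (h x)

mutual
  renTy-renTy : ∀ {ρ ρ' ρ''} → (∀ x → ρ (ρ' x) ≡ ρ'' x) → ∀ t → renTy ρ (renTy ρ' t) ≡ renTy ρ'' t
  renTy-renTy h (tv x)  = cong tv (h x)
  renTy-renTy h 𝟙       = refl
  renTy-renTy h (a ⊗ b) = cong₂ _⊗_ (renTy-renTy h a) (renTy-renTy h b)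
  renTy-renTy h (a ⇒ b) = cong₂ _⇒_ (renTy-renTy h a) (renTy-renTy h b)
  renTy-renTy h (μ ts)  = cong μ (renTys-renTys (ext-fusion h) ts)
  renTy-renTy h (∀ᵗ a)  = cong ∀ᵗ (renTy-renTy (ext-fusion h) a)

  renTys-renTys : ∀ {n ρ ρ' ρ''} → (∀ x → ρ (ρ' x) ≡ ρ'' x) → (ts : Vec Ty n) →
                  renTys ρ (renTys ρ' ts) ≡ renTys ρ'' ts
  renTys-renTys h []       = refl
  renTys-renTys h (t ∷ ts) = cong₂ _∷_ (renTy-renTy h t) (renTys-renTys h ts)

extsTy-ext : ∀ {σ ρ σ''} → (∀ x → σ (ρ x) ≡ σ'' x) → ∀ x → extsTy σ (ext ρ x) ≡ extsTy σ'' x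
extsTy-ext h zero    = refl
extsTy-ext h (suc x) = cong (renTy suc) (h x)

mutual
  subTy-renTy : ∀ {σ ρ σ''} → (∀ x → σ (ρ x) ≡ σ'' x) → ∀ t → subTy σ (renTy ρ t) ≡ subTy σ'' t
  subTy-renTy h (tv x)  = h x
  subTy-renTy h 𝟙       = refl
  subTy-renTy h (a ⊗ b) = cong₂ _⊗_ (subTy-renTy h a) (subTy-renTy h b)
  subTy-renTy h (a ⇒ b) = cong₂ _⇒_ (subTy-renTy h a) (subTy-renTy h b)
  subTy-renTy h (μ ts)  = cong μ (subTys-renTys (extsTy-ext h) ts)
  subTy-renTy h (∀ᵗ a)  = cong ∀ᵗ (subTy-renTy (extsTy-ext h) a)

  subTys-renTys : ∀ {n σ ρ σ''} → (∀ x → σ (ρ x) ≡ σ'' x) → (ts : Vec Ty n) →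
                  subTys σ (renTys ρ ts) ≡ subTys σ'' ts
  subTys-renTys h []       = refl
  subTys-renTys h (t ∷ ts) = cong₂ _∷_ (subTy-renTy h t) (subTys-renTys h ts)

ext-extsTy : ∀ {ρ σ σ''} → (∀ x → renTy ρ (σ x) ≡ σ'' x) →
             ∀ x → renTy (ext ρ) (extsTy σ x) ≡ extsTy σ'' x
ext-extsTy h zero = refl
ext-extsTy {ρ} {σ} {σ''} h (suc x) = begin
  renTy (ext ρ) (renTy suc (σ x))  ≡⟨ renTy-renTy (λ _ → refl) (σ x) ⟩
  renTy (suc ∘ ρ) (σ x)            ≡⟨ sym (renTy-renTy (λ _ → refl) (σ x)) ⟩
  renTy suc (renTy ρ (σ x))        ≡⟨ cong (renTy suc) (h x) ⟩
  renTy suc (σ'' x)                ∎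
  where open ≡-Reasoning

mutual
  renTy-subTy : ∀ {ρ σ σ''} → (∀ x → renTy ρ (σ x) ≡ σ'' x) → ∀ t → renTy ρ (subTy σ t) ≡ subTy σ'' t
  renTy-subTy h (tv x)  = h x
  renTy-subTy h 𝟙       = refl
  renTy-subTy h (a ⊗ b) = cong₂ _⊗_ (renTy-subTy h a) (renTy-subTy h b)
  renTy-subTy h (a ⇒ b) = cong₂ _⇒_ (renTy-subTy h a) (renTy-subTy h b)
  renTy-subTy h (μ ts)  = cong μ (renTys-subTys (ext-extsTy h) ts)
  renTy-subTy h (∀ᵗ a)  = cong ∀ᵗ (renTy-subTy (ext-extsTy h) a)

  renTys-subTys : ∀ {n ρ σ σ''} → (∀ x → renTy ρ (σ x) ≡ σ'' x) → (ts : Vec Ty n) →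
                  renTys ρ (subTys σ ts) ≡ subTys σ'' ts
  renTys-subTys h []       = refl
  renTys-subTys h (t ∷ ts) = cong₂ _∷_ (renTy-subTy h t) (renTys-subTys h ts)

extsTy-shift : ∀ σ t → subTy (extsTy σ) (renTy suc t) ≡ renTy suc (subTy σ t)
extsTy-shift σ t = trans (subTy-renTy (λ _ → refl) t) (sym (renTy-subTy (λ _ → refl) t))

extsTy-extsTy : ∀ {σ σ' σ''} → (∀ x → subTy σ (σ' x) ≡ σ'' x) →
                ∀ x → subTy (extsTy σ) (extsTy σ' x) ≡ extsTy σ'' x
extsTy-extsTy h zero    = refl
extsTy-extsTy {σ} {σ'} h (suc x) = trans (extsTy-shift σ (σ' x)) (cong (renTy suc) (h x))

mutual
  subTy-subTy : ∀ {σ σ' σ''} → (∀ x → subTy σ (σ' x) ≡ σ'' x) → ∀ t → subTy σ (subTy σ' t) ≡ subTy σ'' t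
  subTy-subTy h (tv x)  = h x
  subTy-subTy h 𝟙       = refl
  subTy-subTy h (a ⊗ b) = cong₂ _⊗_ (subTy-subTy h a) (subTy-subTy h b)
  subTy-subTy h (a ⇒ b) = cong₂ _⇒_ (subTy-subTy h a) (subTy-subTy h b)
  subTy-subTy h (μ ts)  = cong μ (subTys-subTys (extsTy-extsTy h) ts)
  subTy-subTy h (∀ᵗ a)  = cong ∀ᵗ (subTy-subTy (extsTy-extsTy h) a)

  subTys-subTys : ∀ {n σ σ' σ''} → (∀ x → subTy σ (σ' x) ≡ σ'' x) → (ts : Vec Ty n) →
                  subTys σ (subTys σ' ts) ≡ subTys σ'' ts
  subTys-subTys h []       = refl
  subTys-subTys h (t ∷ ts) = cong₂ _∷_ (subTy-subTy h t) (subTys-subTys h ts)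

extsTy-id : ∀ {σ} → (∀ x → σ x ≡ tv x) → ∀ x → extsTy σ x ≡ tv x
extsTy-id h zero    = refl
extsTy-id h (suc x) = cong (renTy suc) (h x)

mutual
  subTy-id : ∀ {σ} → (∀ x → σ x ≡ tv x) → ∀ t → subTy σ t ≡ t
  subTy-id h (tv x)  = h x
  subTy-id h 𝟙       = refl
  subTy-id h (a ⊗ b) = cong₂ _⊗_ (subTy-id h a) (subTy-id h b)
  subTy-id h (a ⇒ b) = cong₂ _⇒_ (subTy-id h a) (subTy-id h b)
  subTy-id h (μ ts)  = cong μ (subTys-id (extsTy-id h) ts)
  subTy-id h (∀ᵗ a)  = cong ∀ᵗ (subTy-id (extsTy-id h) a)

  subTys-id : ∀ {n σ} → (∀ x → σ x ≡ tv x) → (ts : Vec Ty n) → subTys σ ts ≡ ts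
  subTys-id h []       = refl
  subTys-id h (t ∷ ts) = cong₂ _∷_ (subTy-id h t) (subTys-id h ts)

subTy-cong : ∀ {σ σ'} → (∀ x → σ x ≡ σ' x) → ∀ t → subTy σ t ≡ subTy σ' t
subTy-cong {σ} h t = trans (cong (subTy σ) (sym (subTy-id (λ _ → refl) t))) (subTy-subTy h t)

ext-as-extsTy : ∀ {ρ σ} → (∀ x → tv (ρ x) ≡ σ x) → ∀ x → tv (ext ρ x) ≡ extsTy σ x
ext-as-extsTy h zero    = refl
ext-as-extsTy h (suc x) = cong (renTy suc) (h x)

mutual
  renTy-as-subTy : ∀ {ρ σ} → (∀ x → tv (ρ x) ≡ σ x) → ∀ t → renTy ρ t ≡ subTy σ t
  renTy-as-subTy h (tv x)  = h x
  renTy-as-subTy h 𝟙       = refl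
  renTy-as-subTy h (a ⊗ b) = cong₂ _⊗_ (renTy-as-subTy h a) (renTy-as-subTy h b)
  renTy-as-subTy h (a ⇒ b) = cong₂ _⇒_ (renTy-as-subTy h a) (renTy-as-subTy h b)
  renTy-as-subTy h (μ ts)  = cong μ (renTys-as-subTys (ext-as-extsTy h) ts)
  renTy-as-subTy h (∀ᵗ a)  = cong ∀ᵗ (renTy-as-subTy (ext-as-extsTy h) a)

  renTys-as-subTys : ∀ {n ρ σ} → (∀ x → tv (ρ x) ≡ σ x) → (ts : Vec Ty n) → renTys ρ ts ≡ subTys σ ts
  renTys-as-subTys h []       = refl
  renTys-as-subTys h (t ∷ ts) = cong₂ _∷_ (renTy-as-subTy h t) (renTys-as-subTys h ts)

lookup-renTys : ∀ {n} ρ (ts : Vec Ty n) i → lookup (renTys ρ ts) i ≡ renTy ρ (lookup ts i)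
lookup-renTys ρ (t ∷ ts) zero    = refl
lookup-renTys ρ (t ∷ ts) (suc i) = lookup-renTys ρ ts i

lookup-subTys : ∀ {n} σ (ts : Vec Ty n) i → lookup (subTys σ ts) i ≡ subTy σ (lookup ts i)
lookup-subTys σ (t ∷ ts) zero    = refl
lookup-subTys σ (t ∷ ts) (suc i) = lookup-subTys σ ts i

unshift : ∀ {τ} → (∀ y → τ (suc y) ≡ tv y) → ∀ u → subTy τ (renTy suc u) ≡ u
unshift h u = trans (subTy-renTy h u) (subTy-id (λ _ → refl) u)

subTy-[]ᵗ : ∀ σ t s → subTy σ (t [ s ]ᵗ) ≡ subTy (extsTy σ) t [ subTy σ s ]ᵗ
subTy-[]ᵗ σ t s =
  trans (subTy-subTy {σ'' = σₛ} (λ { zero → refl ; (suc x) → refl }) t)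
        (sym (subTy-subTy {σ'' = σₛ} (λ { zero → refl ; (suc x) → unshift (λ _ → refl) (σ x) }) t))
  where
    -- the composite substitution: s σ for α, σ elsewhere
    σₛ : ℕ → Ty
    σₛ zero    = subTy σ s
    σₛ (suc x) = σ x

subTy-unfold : ∀ {n} σ (ts : Vec Ty (suc n)) i →
               subTy σ (lookup ts i [ μ ts ]ᵗ) ≡ lookup (subTys (extsTy σ) ts) i [ subTy σ (μ ts) ]ᵗ
subTy-unfold σ ts i =
  trans (subTy-[]ᵗ σ (lookup ts i) (μ ts))
        (cong (_[ subTy σ (μ ts) ]ᵗ) (sym (lookup-subTys (extsTy σ) ts i)))

ext-bounded : ∀ {Δ Δ' ρ} → (∀ {x} → x < Δ → ρ x < Δ') → ∀ {x} → x < suc Δ → ext ρ x < suc Δ'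
ext-bounded h {zero}  p       = z<s
ext-bounded h {suc x} (s<s p) = s<s (h p)

WF-renTy : ∀ {Δ Δ' ρ t} → WF Δ t → (∀ {x} → x < Δ → ρ x < Δ') → WF Δ' (renTy ρ t)
WF-renTy (wf-tv p)   h = wf-tv (h p)
WF-renTy wf-𝟙        h = wf-𝟙
WF-renTy (wf-⊗ a b)  h = wf-⊗ (WF-renTy a h) (WF-renTy b h)
WF-renTy (wf-⇒ a b)  h = wf-⇒ (WF-renTy a h) (WF-renTy b h)
WF-renTy {ρ = ρ} (wf-μ {ts = ts} w) h =
  wf-μ (λ i → subst (WF _) (sym (lookup-renTys (ext ρ) ts i)) (WF-renTy (w i) (ext-bounded h)))
WF-renTy (wf-∀ a)    h = wf-∀ (WF-renTy a (ext-bounded h))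

extsTy-WF : ∀ {Δ Δ' σ} → (∀ {x} → x < Δ → WF Δ' (σ x)) → ∀ {x} → x < suc Δ → WF (suc Δ') (extsTy σ x)
extsTy-WF h {zero}  p       = wf-tv z<s
extsTy-WF h {suc x} (s<s p) = WF-renTy (h p) s<s

WF-subTy : ∀ {Δ Δ' σ t} → WF Δ t → (∀ {x} → x < Δ → WF Δ' (σ x)) → WF Δ' (subTy σ t)
WF-subTy (wf-tv p)  h = h p
WF-subTy wf-𝟙       h = wf-𝟙
WF-subTy (wf-⊗ a b) h = wf-⊗ (WF-subTy a h) (WF-subTy b h)
WF-subTy (wf-⇒ a b) h = wf-⇒ (WF-subTy a h) (WF-subTy b h)
WF-subTy {σ = σ} (wf-μ {ts = ts} w) h =
  wf-μ (λ i → subst (WF _) (sym (lookup-subTys (extsTy σ) ts i)) (WF-subTy (w i) (extsTy-WF h)))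
WF-subTy (wf-∀ a)   h = wf-∀ (WF-subTy a (extsTy-WF h))

extsTy-fixes : ∀ {Δ σ} → (∀ {x} → x < Δ → σ x ≡ tv x) → ∀ {x} → x < suc Δ → extsTy σ x ≡ tv x
extsTy-fixes h {zero}  p       = refl
extsTy-fixes h {suc x} (s<s p) = cong (renTy suc) (h p)

subTy-fixes-WF : ∀ {Δ σ t} → WF Δ t → (∀ {x} → x < Δ → σ x ≡ tv x) → subTy σ t ≡ t
subTy-fixes-WF (wf-tv p)  h = h p
subTy-fixes-WF wf-𝟙       h = refl
subTy-fixes-WF (wf-⊗ a b) h = cong₂ _⊗_ (subTy-fixes-WF a h) (subTy-fixes-WF b h)
subTy-fixes-WF (wf-⇒ a b) h = cong₂ _⇒_ (subTy-fixes-WF a h) (subTy-fixes-WF b h)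
subTy-fixes-WF {σ = σ} (wf-μ {ts = ts} w) h =
  cong μ (vec-ext λ i → trans (lookup-subTys (extsTy σ) ts i) (subTy-fixes-WF (w i) (extsTy-fixes h)))
subTy-fixes-WF (wf-∀ a)   h = cong ∀ᵗ (subTy-fixes-WF a (extsTy-fixes h))

cast-ty : ∀ {Δ Γ e t t'} → t ≡ t' → Δ ⨾ Γ ⊢ e ∶ t → Δ ⨾ Γ ⊢ e ∶ t'
cast-ty refl d = d

cast-ctx : ∀ {Δ Γ Γ' e t} → Γ ≡ Γ' → Δ ⨾ Γ ⊢ e ∶ t → Δ ⨾ Γ' ⊢ e ∶ t
cast-ctx refl d = d

cast-tm : ∀ {Δ Γ e e' t} → e ≡ e' → Δ ⨾ Γ ⊢ e ∶ t → Δ ⨾ Γ ⊢ e' ∶ t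
cast-tm refl d = d

∋-map : ∀ {Γ x t} (f : Ty → Ty) → Γ ∋ x ∶ t → map f Γ ∋ x ∶ f t
∋-map f here      = here
∋-map f (there p) = there (∋-map f p)

∋-map-inv : ∀ {Γ x t} (f : Ty → Ty) → map f Γ ∋ x ∶ t → Σ Ty λ t' → (Γ ∋ x ∶ t') × (t ≡ f t')
∋-map-inv {_ ∷ Γ} f here = _ , here , refl
∋-map-inv {_ ∷ Γ} f (there p) with ∋-map-inv f p
... | t' , q , eq = t' , there q , eq

∋-bound : ∀ {Γ x t} → Γ ∋ x ∶ t → x < length Γ
∋-bound here      = z<s
∋-bound (there p) = s<s (∋-bound p)

<-length-map : ∀ {x} (f : Ty → Ty) (Γ : Ctx) → x < length (map f Γ) → x < length Γ
<-length-map f Γ p = subst (_ <_) (length-map f Γ) p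

map-map-cong : ∀ {f g h k : Ty → Ty} → (∀ t → f (g t) ≡ h (k t)) → ∀ Γ → map f (map g Γ) ≡ map h (map k Γ)
map-map-cong e Γ = trans (sym (map-∘ Γ)) (trans (map-cong e Γ) (map-∘ Γ))

TypedRen : Ctx → (ℕ → ℕ) → Ctx → Set
TypedRen Γ ρ Γ' = ∀ {x t} → Γ ∋ x ∶ t → Γ' ∋ ρ x ∶ t

TypedRen-ext : ∀ {Γ Γ' ρ s} → TypedRen Γ ρ Γ' → TypedRen (s ∷ Γ) (ext ρ) (s ∷ Γ')
TypedRen-ext h here      = here
TypedRen-ext h (there p) = there (h p)

TypedRen-map : ∀ {Γ Γ' ρ} (f : Ty → Ty) → TypedRen Γ ρ Γ' → TypedRen (map f Γ) ρ (map f Γ')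
TypedRen-map {ρ = ρ} f h {x} p with ∋-map-inv f p
... | t' , q , refl = ∋-map f (h q)

lookup-renTs : ∀ {n} ρ (bs : Vec Tm n) i → lookup (renTs ρ bs) i ≡ renT ρ (lookup bs i)
lookup-renTs ρ (b ∷ bs) zero    = refl
lookup-renTs ρ (b ∷ bs) (suc i) = lookup-renTs ρ bs i

lookup-subTs : ∀ {n} σ (bs : Vec Tm n) i → lookup (subTs σ bs) i ≡ subT σ (lookup bs i)
lookup-subTs σ (b ∷ bs) zero    = refl
lookup-subTs σ (b ∷ bs) (suc i) = lookup-subTs σ bs i

lookup-subTyTs : ∀ {n} σ (bs : Vec Tm n) i → lookup (subTyTs σ bs) i ≡ subTyT σ (lookup bs i)
lookup-subTyTs σ (b ∷ bs) zero    = refl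
lookup-subTyTs σ (b ∷ bs) (suc i) = lookup-subTyTs σ bs i

⊢-ren : ∀ {Δ Γ Γ' ρ e t} → Δ ⨾ Γ ⊢ e ∶ t → TypedRen Γ ρ Γ' → Δ ⨾ Γ' ⊢ renT ρ e ∶ t
⊢-ren (⊢var p)     h = ⊢var (h p)
⊢-ren ⊢⟨⟩          h = ⊢⟨⟩
⊢-ren (⊢pair a b)  h = ⊢pair (⊢-ren a h) (⊢-ren b h)
⊢-ren (⊢ƛ w d)     h = ⊢ƛ w (⊢-ren d (TypedRen-ext h))
⊢-ren (⊢inj w i d) h = ⊢inj w i (⊢-ren d h)
⊢-ren (⊢Λ d)       h = ⊢Λ (⊢-ren d (TypedRen-map (renTy suc) h))
⊢-ren ⊢？          h = ⊢？
⊢-ren (⊢fst d)     h = ⊢fst (⊢-ren d h)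
⊢-ren (⊢snd d)     h = ⊢snd (⊢-ren d h)
⊢-ren (⊢app a b)   h = ⊢app (⊢-ren a h) (⊢-ren b h)
⊢-ren {ρ = ρ} (⊢case {bs = bs} dv dbs) h =
  ⊢case (⊢-ren dv h) (λ i → cast-tm (sym (lookup-renTs (ext ρ) bs i)) (⊢-ren (dbs i) (TypedRen-ext h)))
⊢-ren (⊢tapp d w)  h = ⊢tapp (⊢-ren d h) w

⊢-tysub : ∀ {Δ Δ' Γ σ e t} → Δ ⨾ Γ ⊢ e ∶ t → (∀ {x} → x < Δ → WF Δ' (σ x)) →
          Δ' ⨾ map (subTy σ) Γ ⊢ subTyT σ e ∶ subTy σ t
⊢-tysub (⊢var p)    h = ⊢var (∋-map _ p)
⊢-tysub ⊢⟨⟩         h = ⊢⟨⟩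
⊢-tysub (⊢pair a b) h = ⊢pair (⊢-tysub a h) (⊢-tysub b h)
⊢-tysub (⊢ƛ w d)    h = ⊢ƛ (WF-subTy w h) (⊢-tysub d h)
⊢-tysub {σ = σ} (⊢inj {ts = ts} w i d) h =
  ⊢inj (WF-subTy w h) i (cast-ty (subTy-unfold σ ts i) (⊢-tysub d h))
⊢-tysub {Γ = Γ} {σ = σ} (⊢Λ d) h =
  ⊢Λ (cast-ctx (map-map-cong (extsTy-shift σ) Γ) (⊢-tysub d (extsTy-WF h)))
⊢-tysub ⊢？         h = ⊢？
⊢-tysub (⊢fst d)    h = ⊢fst (⊢-tysub d h)
⊢-tysub (⊢snd d)    h = ⊢snd (⊢-tysub d h)
⊢-tysub (⊢app a b)  h = ⊢app (⊢-tysub a h) (⊢-tysub b h)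
⊢-tysub {σ = σ} (⊢case {ts = ts} {bs = bs} dv dbs) h =
  ⊢case (⊢-tysub dv h) (λ i → cast-tm (sym (lookup-subTyTs σ bs i))
    (cast-ctx (cong (_∷ _) (subTy-unfold σ ts i)) (⊢-tysub (dbs i) h)))
⊢-tysub {σ = σ} (⊢tapp {τ = t} {σ = s} d w) h =
  cast-ty (sym (subTy-[]ᵗ σ t s)) (⊢tapp (⊢-tysub d h) (WF-subTy w h))

mutual
  renTyV-as-subTyV : ∀ {ρ σ} → (∀ x → tv (ρ x) ≡ σ x) → ∀ v → renTyV ρ v ≡ subTyV σ v
  renTyV-as-subTyV h (var x)     = refl
  renTyV-as-subTyV h ⟨⟩          = refl
  renTyV-as-subTyV h ⟨ a , b ⟩   = cong₂ ⟨_,_⟩ (renTyV-as-subTyV h a) (renTyV-as-subTyV h b)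
  renTyV-as-subTyV h (ƛ e)       = cong ƛ (renTyT-as-subTyT h e)
  renTyV-as-subTyV h (inj i v)   = cong (inj i) (renTyV-as-subTyV h v)
  renTyV-as-subTyV h (Λ e)       = cong Λ (renTyT-as-subTyT (ext-as-extsTy h) e)

  renTyT-as-subTyT : ∀ {ρ σ} → (∀ x → tv (ρ x) ≡ σ x) → ∀ e → renTyT ρ e ≡ subTyT σ e
  renTyT-as-subTyT h (val v)     = cong val (renTyV-as-subTyV h v)
  renTyT-as-subTyT h ？          = refl
  renTyT-as-subTyT h (fst v)     = cong fst (renTyV-as-subTyV h v)
  renTyT-as-subTyT h (snd v)     = cong snd (renTyV-as-subTyV h v)
  renTyT-as-subTyT h (v · e)     = cong₂ _·_ (renTyV-as-subTyV h v) (renTyT-as-subTyT h e)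
  renTyT-as-subTyT h (case v bs) = cong₂ case (renTyV-as-subTyV h v) (renTyTs-as-subTyTs h bs)
  renTyT-as-subTyT h (tapp v t)  = cong₂ tapp (renTyV-as-subTyV h v) (renTy-as-subTy h t)

  renTyTs-as-subTyTs : ∀ {n ρ σ} → (∀ x → tv (ρ x) ≡ σ x) → (bs : Vec Tm n) → renTyTs ρ bs ≡ subTyTs σ bs
  renTyTs-as-subTyTs h []       = refl
  renTyTs-as-subTyTs h (b ∷ bs) = cong₂ _∷_ (renTyT-as-subTyT h b) (renTyTs-as-subTyTs h bs)

⊢-tyshift : ∀ {Δ Γ e t} → Δ ⨾ Γ ⊢ e ∶ t → suc Δ ⨾ map (renTy suc) Γ ⊢ renTyT suc e ∶ renTy suc t
⊢-tyshift {Γ = Γ} {e} {t} d =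
  cast-ctx (map-cong (λ s → sym (renTy-as-subTy (λ _ → refl) s)) Γ)
    (cast-tm (sym (renTyT-as-subTyT (λ _ → refl) e))
      (cast-ty (sym (renTy-as-subTy (λ _ → refl) t))
        (⊢-tysub {σ = tv ∘ suc} d (λ p → wf-tv (s<s p)))))

TypedSub : ℕ → Ctx → (ℕ → Val) → Ctx → Set
TypedSub Δ Γ σ Γ' = ∀ {x t} → Γ ∋ x ∶ t → Δ ⨾ Γ' ⊢ val (σ x) ∶ t

TypedSub-ext : ∀ {Δ Γ Γ' σ s} → TypedSub Δ Γ σ Γ' → TypedSub Δ (s ∷ Γ) (extsV σ) (s ∷ Γ')
TypedSub-ext h here      = ⊢var here
TypedSub-ext h (there p) = ⊢-ren (h p) there

TypedSub-Λ : ∀ {Δ Γ Γ' σ} → TypedSub Δ Γ σ Γ' →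
             TypedSub (suc Δ) (map (renTy suc) Γ) (renTyV suc ∘ σ) (map (renTy suc) Γ')
TypedSub-Λ h p with ∋-map-inv (renTy suc) p
... | t' , q , refl = ⊢-tyshift (h q)

⊢-sub : ∀ {Δ Γ Γ' σ e t} → Δ ⨾ Γ ⊢ e ∶ t → TypedSub Δ Γ σ Γ' → Δ ⨾ Γ' ⊢ subT σ e ∶ t
⊢-sub (⊢var p)     h = h p
⊢-sub ⊢⟨⟩          h = ⊢⟨⟩
⊢-sub (⊢pair a b)  h = ⊢pair (⊢-sub a h) (⊢-sub b h)
⊢-sub (⊢ƛ w d)     h = ⊢ƛ w (⊢-sub d (TypedSub-ext h))
⊢-sub (⊢inj w i d) h = ⊢inj w i (⊢-sub d h)
⊢-sub (⊢Λ d)       h = ⊢Λ (⊢-sub d (TypedSub-Λ h))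
⊢-sub ⊢？          h = ⊢？
⊢-sub (⊢fst d)     h = ⊢fst (⊢-sub d h)
⊢-sub (⊢snd d)     h = ⊢snd (⊢-sub d h)
⊢-sub (⊢app a b)   h = ⊢app (⊢-sub a h) (⊢-sub b h)
⊢-sub {σ = σ} (⊢case {bs = bs} dv dbs) h =
  ⊢case (⊢-sub dv h) (λ i → cast-tm (sym (lookup-subTs (extsV σ) bs i)) (⊢-sub (dbs i) (TypedSub-ext h)))
⊢-sub (⊢tapp d w)  h = ⊢tapp (⊢-sub d h) w

⊢-sub₀ : ∀ {Δ Γ e v s t} → Δ ⨾ (s ∷ Γ) ⊢ e ∶ t → Δ ⨾ Γ ⊢ val v ∶ s → Δ ⨾ Γ ⊢ e [ v ]ᵉ ∶ t
⊢-sub₀ d dv = ⊢-sub d (λ { here → dv ; (there p) → ⊢var p })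

⊢-tyinst : ∀ {Δ Γ e s t} → suc Δ ⨾ map (renTy suc) Γ ⊢ e ∶ t → WF Δ s → Δ ⨾ Γ ⊢ e [ s ]ᵀ ∶ t [ s ]ᵗ
⊢-tyinst {Γ = Γ} {t = t} d w =
  cast-ty (subTy-cong (λ { zero → refl ; (suc x) → refl }) t)
    (cast-ctx (trans (sym (map-∘ Γ)) (trans (map-cong (unshift (λ _ → refl)) Γ) (map-id Γ)))
      (⊢-tysub d (λ { {zero} p → w ; {suc x} (s<s p) → wf-tv p })))

inj-inv : ∀ {Δ Γ k v n} {ts : Vec Ty (suc n)} → Δ ⨾ Γ ⊢ val (inj k v) ∶ μ ts →
          Σ (Fin (suc n)) λ i → (toℕ i ≡ k) × (Δ ⨾ Γ ⊢ val v ∶ lookup ts i [ μ ts ]ᵗ)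
inj-inv (⊢inj w i d) = i , refl , d

wf-nat : ∀ {Δ} → WF Δ nat
wf-nat = wf-μ (λ { zero → wf-𝟙 ; (suc zero) → wf-tv z<s })

⊢num : ∀ {Δ Γ} n → Δ ⨾ Γ ⊢ val (num n) ∶ nat
⊢num zero    = ⊢inj wf-nat zero ⊢⟨⟩
⊢num (suc n) = ⊢inj wf-nat (suc zero) (⊢num n)

preservation : ∀ {Δ Γ e e' t} → e ⟶ e' → Δ ⨾ Γ ⊢ e ∶ t → Δ ⨾ Γ ⊢ e' ∶ t
preservation β-fst      (⊢fst (⊢pair a b))  = a
preservation β-snd      (⊢snd (⊢pair a b))  = b
preservation β-ƛ        (⊢app (⊢ƛ w d) dv) = ⊢-sub₀ d dv
preservation β-Λ        (⊢tapp (⊢Λ d) w)   = ⊢-tyinst d w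
preservation (β-case j) (⊢case dv dbs) with inj-inv dv
... | i , same-tag , dpayload with toℕ-injective same-tag
... | refl = ⊢-sub₀ (dbs i) dpayload
preservation (β-？ n)    ⊢？                 = ⊢num n
preservation (ξ-app s)  (⊢app a b)         = ⊢app a (preservation s b)

-- A substitution which fixes every variable in scope fixes
-- a well-typed term; hence a closed well-typed term is fixed by every
-- renaming and substitution of term and of type variables.

val-inj : ∀ {a b} → val a ≡ val b → a ≡ b
val-inj refl = refl

ext-fixes : ∀ {n ρ} → (∀ {x} → x < n → ρ x ≡ x) → ∀ {x} → x < suc n → ext ρ x ≡ x
ext-fixes h {zero}  p       = refl
ext-fixes h {suc x} (s<s p) = cong suc (h p)

extsV-fixes : ∀ {n σ} → (∀ {x} → x < n → σ x ≡ var x) → ∀ {x} → x < suc n → extsV σ x ≡ var x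
extsV-fixes h {zero}  p       = refl
extsV-fixes h {suc x} (s<s p) = cong (renV suc) (h p)

renT-fixes : ∀ {Δ Γ ρ e t} → Δ ⨾ Γ ⊢ e ∶ t → (∀ {x} → x < length Γ → ρ x ≡ x) → renT ρ e ≡ e
renT-fixes (⊢var p)     h = cong (val ∘ var) (h (∋-bound p))
renT-fixes ⊢⟨⟩          h = refl
renT-fixes (⊢pair a b)  h = cong₂ (λ x y → val ⟨ x , y ⟩) (val-inj (renT-fixes a h)) (val-inj (renT-fixes b h))
renT-fixes (⊢ƛ w d)     h = cong (val ∘ ƛ) (renT-fixes d (ext-fixes h))
renT-fixes (⊢inj w i d) h = cong (val ∘ inj (toℕ i)) (val-inj (renT-fixes d h))
renT-fixes {Γ = Γ} (⊢Λ d) h = cong (val ∘ Λ) (renT-fixes d (λ p → h (<-length-map (renTy suc) Γ p)))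
renT-fixes ⊢？          h = refl
renT-fixes (⊢fst d)     h = cong fst (val-inj (renT-fixes d h))
renT-fixes (⊢snd d)     h = cong snd (val-inj (renT-fixes d h))
renT-fixes (⊢app a b)   h = cong₂ _·_ (val-inj (renT-fixes a h)) (renT-fixes b h)
renT-fixes {ρ = ρ} (⊢case {bs = bs} dv dbs) h =
  cong₂ case (val-inj (renT-fixes dv h))
    (vec-ext λ i → trans (lookup-renTs (ext ρ) bs i) (renT-fixes (dbs i) (ext-fixes h)))
renT-fixes (⊢tapp d w)  h = cong (λ a → tapp a _) (val-inj (renT-fixes d h))

subT-fixes : ∀ {Δ Γ σ e t} → Δ ⨾ Γ ⊢ e ∶ t → (∀ {x} → x < length Γ → σ x ≡ var x) → subT σ e ≡ e
subT-fixes (⊢var p)     h = cong val (h (∋-bound p))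
subT-fixes ⊢⟨⟩          h = refl
subT-fixes (⊢pair a b)  h = cong₂ (λ x y → val ⟨ x , y ⟩) (val-inj (subT-fixes a h)) (val-inj (subT-fixes b h))
subT-fixes (⊢ƛ w d)     h = cong (val ∘ ƛ) (subT-fixes d (extsV-fixes h))
subT-fixes (⊢inj w i d) h = cong (val ∘ inj (toℕ i)) (val-inj (subT-fixes d h))
subT-fixes {Γ = Γ} (⊢Λ d) h =
  cong (val ∘ Λ) (subT-fixes d (λ p → cong (renTyV suc) (h (<-length-map (renTy suc) Γ p))))
subT-fixes ⊢？          h = refl
subT-fixes (⊢fst d)     h = cong fst (val-inj (subT-fixes d h))
subT-fixes (⊢snd d)     h = cong snd (val-inj (subT-fixes d h))
subT-fixes (⊢app a b)   h = cong₂ _·_ (val-inj (subT-fixes a h)) (subT-fixes b h)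
subT-fixes {σ = σ} (⊢case {bs = bs} dv dbs) h =
  cong₂ case (val-inj (subT-fixes dv h))
    (vec-ext λ i → trans (lookup-subTs (extsV σ) bs i) (subT-fixes (dbs i) (extsV-fixes h)))
subT-fixes (⊢tapp d w)  h = cong (λ a → tapp a _) (val-inj (subT-fixes d h))

subTyT-fixes : ∀ {Δ Γ σ e t} → Δ ⨾ Γ ⊢ e ∶ t → (∀ {x} → x < Δ → σ x ≡ tv x) → subTyT σ e ≡ e
subTyT-fixes (⊢var p)     h = refl
subTyT-fixes ⊢⟨⟩          h = refl
subTyT-fixes (⊢pair a b)  h = cong₂ (λ x y → val ⟨ x , y ⟩) (val-inj (subTyT-fixes a h)) (val-inj (subTyT-fixes b h))
subTyT-fixes (⊢ƛ w d)     h = cong (val ∘ ƛ) (subTyT-fixes d h)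
subTyT-fixes (⊢inj w i d) h = cong (val ∘ inj (toℕ i)) (val-inj (subTyT-fixes d h))
subTyT-fixes (⊢Λ d)       h = cong (val ∘ Λ) (subTyT-fixes d (extsTy-fixes h))
subTyT-fixes ⊢？          h = refl
subTyT-fixes (⊢fst d)     h = cong fst (val-inj (subTyT-fixes d h))
subTyT-fixes (⊢snd d)     h = cong snd (val-inj (subTyT-fixes d h))
subTyT-fixes (⊢app a b)   h = cong₂ _·_ (val-inj (subTyT-fixes a h)) (subTyT-fixes b h)
subTyT-fixes {σ = σ} (⊢case {bs = bs} dv dbs) h =
  cong₂ case (val-inj (subTyT-fixes dv h))
    (vec-ext λ i → trans (lookup-subTyTs σ bs i) (subTyT-fixes (dbs i) h))
subTyT-fixes (⊢tapp d w)  h = cong₂ tapp (val-inj (subTyT-fixes d h)) (subTy-fixes-WF w h)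

record ClosedTm (e : Tm) : Set where
  field
    ren-fixed   : ∀ ρ → renT ρ e ≡ e
    sub-fixed   : ∀ σ → subT σ e ≡ e
    tyren-fixed : ∀ ρ → renTyT ρ e ≡ e
    tysub-fixed : ∀ σ → subTyT σ e ≡ e
open ClosedTm

ClosedVal : Val → Set
ClosedVal v = ClosedTm (val v)

closed-typed : ∀ {e t} → 0 ⨾ [] ⊢ e ∶ t → ClosedTm e
closed-typed {e} d = record
  { ren-fixed   = λ ρ → renT-fixes d (λ ())
  ; sub-fixed   = λ σ → subT-fixes d (λ ())
  ; tyren-fixed = λ ρ → trans (renTyT-as-subTyT (λ _ → refl) e) (subTyT-fixes d (λ ()))
  ; tysub-fixed = λ σ → subTyT-fixes d (λ ())
  }

⊢-weaken-closed : ∀ {Δ Γ e t} → 0 ⨾ [] ⊢ e ∶ t → Δ ⨾ Γ ⊢ e ∶ t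
⊢-weaken-closed {Δ} {e = e} {t} d =
  cast-tm (ren-fixed (closed-typed d) (λ x → x))
    (⊢-ren (cast-tm (tysub-fixed (closed-typed d) tv)
             (cast-ty (subTy-id (λ _ → refl) t) (⊢-tysub {Δ' = Δ} {σ = tv} d (λ ()))))
           (λ ()))

diverge-by-unfolding : ∀ {S : Set} (term : S → Tm) → (∀ s → Σ S λ s' → term s ⟶ term s') →
                       ∀ s₀ → MayDiverge (term s₀)
diverge-by-unfolding {S} term step s₀ = (term ∘ run) , refl , (λ n → proj₂ (step (run n)))
  where
    run : ℕ → S
    run zero    = s₀
    run (suc n) = proj₁ (step (run n))

diverge-back : ∀ {e e'} → e ⟶ e' → MayDiverge e' → MayDiverge e
diverge-back {e} s (f , refl , steps) = f' , refl , steps'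
  where
    f' : ℕ → Tm
    f' zero    = e
    f' (suc n) = f n
    steps' : ∀ n → f' n ⟶ f' (suc n)
    steps' zero    = s
    steps' (suc n) = steps n

diverge-back* : ∀ {e e'} → Star _⟶_ e e' → MayDiverge e' → MayDiverge e
diverge-back* ε       d = d
diverge-back* (s ◅ p) d = diverge-back s (diverge-back* p d)

diverge-step : ∀ {e} → MayDiverge e → Σ Tm λ e' → (e ⟶ e') × MayDiverge e'
diverge-step (f , refl , steps) = f 1 , steps 0 , (f ∘ suc) , refl , (steps ∘ suc)

diverge-arg : ∀ {v e} → MayDiverge e → MayDiverge (v · e)
diverge-arg {v} (f , refl , steps) = (λ n → v · f n) , refl , (λ n → ξ-app (steps n))

value-converges : ∀ {v} → ¬ MayDiverge (val v)
value-converges (f , f0≡v , steps) with subst (_⟶ f 1) f0≡v (steps 0)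
... | ()

diverge-by-cycle : ∀ {e e₁} → e ⟶ e₁ → Star _⟶_ e₁ e → MayDiverge e
diverge-by-cycle {e} first rest = diverge-by-unfolding proj₁ step (e , ε)
  where
    -- a state is a term on the cycle together with the path back to e
    step : (s : Σ Tm λ x → Star _⟶_ x e) → Σ (Σ Tm λ x → Star _⟶_ x e) λ s' → proj₁ s ⟶ proj₁ s'
    step (x , ε)     = (_ , rest) , first
    step (x , s ◅ p) = (_ , p) , s

-- Ω[τ] diverges: after six administrative steps it reaches the loop of
-- fix[𝟙][τ] (λf.f), which returns to itself in five steps.

-- δ_f from the definition of fix, with f the identity.
δ-id : Val
δ-id = ƛ (case (var 0) ((ƛ (val (var 0)) · val (ƛ (ƛ (var 0 · val (var 1)) · (var 1 · val (var 2))))) ∷ []))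

-- λx. (λr. r x) (δ (in δ)), the function computed by one unfolding of fix
Ω-unfolding : Val
Ω-unfolding = ƛ (ƛ (var 0 · val (var 1)) · (δ-id · val (inj 0 δ-id)))

-- apply the result of fix to ⟨⟩
at-unit : Val
at-unit = ƛ (var 0 · val ⟨⟩)

Ω-loop : Tm
Ω-loop = at-unit · (δ-id · val (inj 0 δ-id))

Ω-loop-diverges : MayDiverge Ω-loop
Ω-loop-diverges = diverge-by-cycle (ξ-app β-ƛ) (ξ-app (β-case zero) ◅ ξ-app β-ƛ ◅ unfolded ◅ β-ƛ ◅ ε)
  where
    unfolded : at-unit · val Ω-unfolding ⟶ Ω-unfolding · val ⟨⟩
    unfolded = β-ƛ

Ω-diverges : ∀ τ → MayDiverge (tapp Ω τ)
Ω-diverges τ =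
  diverge-back* (β-Λ ◅ ξ-app β-Λ ◅ β-ƛ ◅ ξ-app β-Λ ◅ β-ƛ ◅ ξ-app β-ƛ ◅ ε) Ω-loop-diverges

⊢fix : ∀ {Δ} → Δ ⨾ [] ⊢ val fix ∶ ∀ᵗ (∀ᵗ (((tv 1 ⇒ tv 0) ⇒ (tv 1 ⇒ tv 0)) ⇒ (tv 1 ⇒ tv 0)))
⊢fix = ⊢Λ (⊢Λ (⊢ƛ wf-F (⊢app ⊢δ (⊢inj wf-M zero ⊢δ))))
  where
    wf-F : ∀ {Δ} → WF (suc (suc Δ)) ((tv 1 ⇒ tv 0) ⇒ (tv 1 ⇒ tv 0))
    wf-F = wf-⇒ (wf-⇒ (wf-tv (s<s z<s)) (wf-tv z<s)) (wf-⇒ (wf-tv (s<s z<s)) (wf-tv z<s))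
    -- the recursive type μγ. γ → (α → β) of self-applicable functions
    wf-M : ∀ {Δ} → WF (suc (suc Δ)) (μ ((tv 0 ⇒ (tv 2 ⇒ tv 1)) ∷ []))
    wf-M = wf-μ (λ { zero → wf-⇒ (wf-tv z<s) (wf-⇒ (wf-tv (s<s (s<s z<s))) (wf-tv (s<s z<s))) })
    ⊢δ : ∀ {Δ} → suc (suc Δ) ⨾ (((tv 1 ⇒ tv 0) ⇒ (tv 1 ⇒ tv 0)) ∷ []) ⊢
         val (ƛ (case (var 0) ((var 2 · val (ƛ (ƛ (var 0 · val (var 1)) · (var 1 · val (var 2))))) ∷ [])))
         ∶ μ ((tv 0 ⇒ (tv 2 ⇒ tv 1)) ∷ []) ⇒ (tv 1 ⇒ tv 0)
    ⊢δ = ⊢ƛ wf-M (⊢case (⊢var here) (λ { zero → ⊢app (⊢var (there (there here)))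
           (⊢ƛ (wf-tv (s<s z<s))
             (⊢app (⊢ƛ (wf-⇒ (wf-tv (s<s z<s)) (wf-tv z<s)) (⊢app (⊢var here) (⊢var (there here))))
                   (⊢app (⊢var (there here)) (⊢var (there (there here)))))) }))

⊢Ω : 0 ⨾ [] ⊢ val Ω ∶ ∀ᵗ (tv 0)
⊢Ω = ⊢Λ (⊢app ⊢let-a (⊢tapp ⊢fix wf-𝟙))
  where
    -- Ω unfolds as  let a = fix[𝟙] in let b = a[α] in let c = b (λf.f) in c ⟨⟩
    wf-1α : ∀ {Δ} → WF (suc Δ) (𝟙 ⇒ tv 0)
    wf-1α = wf-⇒ wf-𝟙 (wf-tv z<s)
    ⊢let-c : ∀ {Γ} → 1 ⨾ Γ ⊢ val (ƛ (var 0 · val ⟨⟩)) ∶ (𝟙 ⇒ tv 0) ⇒ tv 0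
    ⊢let-c = ⊢ƛ wf-1α (⊢app (⊢var here) ⊢⟨⟩)
    ⊢let-b : ∀ {Γ} → 1 ⨾ Γ ⊢ val (ƛ (ƛ (var 0 · val ⟨⟩) · (var 0 · val (ƛ (val (var 0))))))
                            ∶ (((𝟙 ⇒ tv 0) ⇒ (𝟙 ⇒ tv 0)) ⇒ (𝟙 ⇒ tv 0)) ⇒ tv 0
    ⊢let-b = ⊢ƛ (wf-⇒ (wf-⇒ wf-1α wf-1α) wf-1α) (⊢app ⊢let-c (⊢app (⊢var here) (⊢ƛ wf-1α (⊢var here))))
    ⊢let-a : 1 ⨾ [] ⊢ val (ƛ (ƛ (ƛ (var 0 · val ⟨⟩) · (var 0 · val (ƛ (val (var 0))))) · tapp (var 0) (tv 0)))
                   ∶ ∀ᵗ (((𝟙 ⇒ tv 0) ⇒ (𝟙 ⇒ tv 0)) ⇒ (𝟙 ⇒ tv 0)) ⇒ tv 0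
    ⊢let-a = ⊢ƛ (wf-∀ (wf-⇒ (wf-⇒ wf-1α wf-1α) wf-1α)) (⊢app ⊢let-b (⊢tapp (⊢var here) (wf-tv z<s)))

-- Instantiations.  An instantiation P says, for each free term variable x
-- of an open term, whether x is kept (P x = nothing) or stands for the
-- closed value U (P x = just U).
Inst : Set
Inst = ℕ → Maybe Val

liftI : Inst → Inst
liftI P zero    = nothing
liftI P (suc x) = P x

record ClosedInst (P : Inst) : Set where
  field
    closed : ∀ x {U} → P x ≡ just U → ClosedVal U
open ClosedInst

ClosedInst-lift : ∀ {P} → ClosedInst P → ClosedInst (liftI P)
ClosedInst-lift c = record { closed = λ { zero () ; (suc x) → closed c x } }

-- X is stuck on an instantiated variable: its next redex eliminates a
-- variable x with P x = just U, so the instance can reduce but X cannot.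
data Stuck (P : Inst) : Tm → Set where
  stuck-fst  : ∀ {x U} → P x ≡ just U → Stuck P (fst (var x))
  stuck-snd  : ∀ {x U} → P x ≡ just U → Stuck P (snd (var x))
  stuck-app  : ∀ {x U e} → P x ≡ just U → Stuck P (var x · e)
  stuck-case : ∀ {x U n} {bs : Vec Tm (suc n)} → P x ≡ just U → Stuck P (case (var x) bs)
  stuck-tapp : ∀ {x U s} → P x ≡ just U → Stuck P (tapp (var x) s)
  stuck-arg  : ∀ {v e} → Stuck P e → Stuck P (v · e)

-- SimT P X Y holds when Y arises from X by
-- replacing each variable instantiated by P with its value, changing type
-- arguments and annotations arbitrarily, and replacing subterms satisfying
-- Base by arbitrary closed terms.  With Base empty this relates an open term
-- to its instances; with Base = divergence it underlies the approximation
-- "divergent terms are below everything".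
module Simulation (Base : Tm → Set) where

  mutual
    data SimV : Inst → Val → Val → Set where
      rvar  : ∀ {P x} → P x ≡ nothing → SimV P (var x) (var x)
      rinst : ∀ {P x U} → P x ≡ just U → SimV P (var x) U
      r⟨⟩   : ∀ {P} → SimV P ⟨⟩ ⟨⟩
      rpair : ∀ {P a a' b b'} → SimV P a a' → SimV P b b' → SimV P ⟨ a , b ⟩ ⟨ a' , b' ⟩
      rƛ    : ∀ {P e e'} → SimT (liftI P) e e' → SimV P (ƛ e) (ƛ e')
      rinj  : ∀ {P i a a'} → SimV P a a' → SimV P (inj i a) (inj i a')
      rΛ    : ∀ {P e e'} → SimT P e e' → SimV P (Λ e) (Λ e')

    data SimT : Inst → Tm → Tm → Set where
      rval  : ∀ {P a a'} → SimV P a a' → SimT P (val a) (val a')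
      rbase : ∀ {P e e'} → Base e → ClosedTm e → ClosedTm e' → SimT P e e'
      r？    : ∀ {P} → SimT P ？ ？
      rfst  : ∀ {P a a'} → SimV P a a' → SimT P (fst a) (fst a')
      rsnd  : ∀ {P a a'} → SimV P a a' → SimT P (snd a) (snd a')
      rapp  : ∀ {P a a' e e'} → SimV P a a' → SimT P e e' → SimT P (a · e) (a' · e')
      rcase : ∀ {P a a' n} {bs bs' : Vec Tm (suc n)} →
              SimV P a a' → SimTs (liftI P) bs bs' → SimT P (case a bs) (case a' bs')
      rtapp : ∀ {P a a' s s'} → SimV P a a' → SimT P (tapp a s) (tapp a' s')

    data SimTs : Inst → ∀ {n} → Vec Tm n → Vec Tm n → Set where
      []  : ∀ {P} → SimTs P [] []
      _∷_ : ∀ {P n e e'} {bs bs' : Vec Tm n} → SimT P e e' → SimTs P bs bs' → SimTs P (e ∷ bs) (e' ∷ bs')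

  sims-lookup : ∀ {P n} {bs bs' : Vec Tm n} → SimTs P bs bs' → ∀ i → SimT P (lookup bs i) (lookup bs' i)
  sims-lookup (r ∷ rs) zero    = r
  sims-lookup (r ∷ rs) (suc i) = sims-lookup rs i

  sims-tabulate : ∀ {P n} (bs bs' : Vec Tm n) → (∀ i → SimT P (lookup bs i) (lookup bs' i)) → SimTs P bs bs'
  sims-tabulate []       []         h = []
  sims-tabulate (b ∷ bs) (b' ∷ bs') h = h zero ∷ sims-tabulate bs bs' (h ∘ suc)

  liftI-ext : ∀ {P Q ρ} → (∀ x → Q (ρ x) ≡ P x) → ∀ x → liftI Q (ext ρ x) ≡ liftI P x
  liftI-ext h zero    = refl
  liftI-ext h (suc x) = h x

  mutual
    sim-renV : ∀ {P Q ρ a a'} → ClosedInst P → (∀ x → Q (ρ x) ≡ P x) →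
               SimV P a a' → SimV Q (renV ρ a) (renV ρ a')
    sim-renV c h (rvar p)          = rvar (trans (h _) p)
    sim-renV {ρ = ρ} c h (rinst {x = x} p) =
      subst (SimV _ (var (ρ x))) (sym (val-inj (ren-fixed (closed c x p) ρ))) (rinst (trans (h x) p))
    sim-renV c h r⟨⟩               = r⟨⟩
    sim-renV c h (rpair a b)       = rpair (sim-renV c h a) (sim-renV c h b)
    sim-renV c h (rƛ r)            = rƛ (sim-renT (ClosedInst-lift c) (liftI-ext h) r)
    sim-renV c h (rinj r)          = rinj (sim-renV c h r)
    sim-renV c h (rΛ r)            = rΛ (sim-renT c h r)

    sim-renT : ∀ {P Q ρ e e'} → ClosedInst P → (∀ x → Q (ρ x) ≡ P x) →
               SimT P e e' → SimT Q (renT ρ e) (renT ρ e')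
    sim-renT c h (rval r)          = rval (sim-renV c h r)
    sim-renT {ρ = ρ} c h (rbase b ce ce') =
      subst₂ (SimT _) (sym (ren-fixed ce ρ)) (sym (ren-fixed ce' ρ)) (rbase b ce ce')
    sim-renT c h r？               = r？
    sim-renT c h (rfst r)          = rfst (sim-renV c h r)
    sim-renT c h (rsnd r)          = rsnd (sim-renV c h r)
    sim-renT c h (rapp r q)        = rapp (sim-renV c h r) (sim-renT c h q)
    sim-renT c h (rcase r rs)      = rcase (sim-renV c h r) (sim-renTs (ClosedInst-lift c) (liftI-ext h) rs)
    sim-renT c h (rtapp r)         = rtapp (sim-renV c h r)

    sim-renTs : ∀ {P Q ρ n} {bs bs' : Vec Tm n} → ClosedInst P → (∀ x → Q (ρ x) ≡ P x) →
                SimTs P bs bs' → SimTs Q (renTs ρ bs) (renTs ρ bs')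
    sim-renTs c h []       = []
    sim-renTs c h (r ∷ rs) = sim-renT c h r ∷ sim-renTs c h rs

  -- Type substitution: the relation ignores types, so any two type
  -- substitutions may be applied on the two sides.
  mutual
    sim-tysubV : ∀ {P σ σ' a a'} → ClosedInst P → SimV P a a' → SimV P (subTyV σ a) (subTyV σ' a')
    sim-tysubV c (rvar p)          = rvar p
    sim-tysubV {σ' = σ'} c (rinst {x = x} p) =
      subst (SimV _ (var x)) (sym (val-inj (tysub-fixed (closed c x p) σ'))) (rinst p)
    sim-tysubV c r⟨⟩               = r⟨⟩
    sim-tysubV c (rpair a b)       = rpair (sim-tysubV c a) (sim-tysubV c b)
    sim-tysubV c (rƛ r)            = rƛ (sim-tysubT (ClosedInst-lift c) r)
    sim-tysubV c (rinj r)          = rinj (sim-tysubV c r)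
    sim-tysubV c (rΛ r)            = rΛ (sim-tysubT c r)

    sim-tysubT : ∀ {P σ σ' e e'} → ClosedInst P → SimT P e e' → SimT P (subTyT σ e) (subTyT σ' e')
    sim-tysubT c (rval r)          = rval (sim-tysubV c r)
    sim-tysubT {σ = σ} {σ'} c (rbase b ce ce') =
      subst₂ (SimT _) (sym (tysub-fixed ce σ)) (sym (tysub-fixed ce' σ')) (rbase b ce ce')
    sim-tysubT c r？               = r？
    sim-tysubT c (rfst r)          = rfst (sim-tysubV c r)
    sim-tysubT c (rsnd r)          = rsnd (sim-tysubV c r)
    sim-tysubT c (rapp r q)        = rapp (sim-tysubV c r) (sim-tysubT c q)
    sim-tysubT c (rcase r rs)      = rcase (sim-tysubV c r) (sim-tysubTs (ClosedInst-lift c) rs)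
    sim-tysubT c (rtapp r)         = rtapp (sim-tysubV c r)

    sim-tysubTs : ∀ {P σ σ' n} {bs bs' : Vec Tm n} → ClosedInst P →
                  SimTs P bs bs' → SimTs P (subTyTs σ bs) (subTyTs σ' bs')
    sim-tysubTs c []       = []
    sim-tysubTs c (r ∷ rs) = sim-tysubT c r ∷ sim-tysubTs c rs

  sim-tyrenV : ∀ {P ρ a a'} → ClosedInst P → SimV P a a' → SimV P (renTyV ρ a) (renTyV ρ a')
  sim-tyrenV {ρ = ρ} {a} {a'} c r =
    subst₂ (SimV _) (sym (renTyV-as-subTyV (λ _ → refl) a)) (sym (renTyV-as-subTyV (λ _ → refl) a'))
      (sim-tysubV {σ = tv ∘ ρ} {σ' = tv ∘ ρ} c r)

  record SimSub (P Q : Inst) (σ σ' : ℕ → Val) : Set where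
    field
      kept : ∀ x → P x ≡ nothing → SimV Q (σ x) (σ' x)
      inst : ∀ x {U} → P x ≡ just U → SimV Q (σ x) U
  open SimSub

  SimSub-lift : ∀ {P Q σ σ'} → ClosedInst P → ClosedInst Q → SimSub P Q σ σ' →
                SimSub (liftI P) (liftI Q) (extsV σ) (extsV σ')
  SimSub-lift cP cQ s = record
    { kept = λ { zero _ → rvar refl ; (suc x) p → sim-renV cQ (λ _ → refl) (kept s x p) }
    ; inst = λ { zero () ; (suc x) p → subst (SimV _ _) (val-inj (ren-fixed (closed cP x p) suc))
                                              (sim-renV cQ (λ _ → refl) (inst s x p)) }
    }

  SimSub-Λ : ∀ {P Q σ σ'} → ClosedInst P → ClosedInst Q → SimSub P Q σ σ' →
             SimSub P Q (renTyV suc ∘ σ) (renTyV suc ∘ σ')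
  SimSub-Λ cP cQ s = record
    { kept = λ x p → sim-tyrenV cQ (kept s x p)
    ; inst = λ x p → subst (SimV _ _) (val-inj (tyren-fixed (closed cP x p) suc)) (sim-tyrenV cQ (inst s x p))
    }

  mutual
    sim-subV : ∀ {P Q σ σ' a a'} → ClosedInst P → ClosedInst Q → SimSub P Q σ σ' →
               SimV P a a' → SimV Q (subV σ a) (subV σ' a')
    sim-subV cP cQ s (rvar p)       = kept s _ p
    sim-subV {σ' = σ'} cP cQ s (rinst {x = x} p) =
      subst (SimV _ _) (sym (val-inj (sub-fixed (closed cP x p) σ'))) (inst s x p)
    sim-subV cP cQ s r⟨⟩            = r⟨⟩
    sim-subV cP cQ s (rpair a b)    = rpair (sim-subV cP cQ s a) (sim-subV cP cQ s b)
    sim-subV cP cQ s (rƛ r)         =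
      rƛ (sim-subT (ClosedInst-lift cP) (ClosedInst-lift cQ) (SimSub-lift cP cQ s) r)
    sim-subV cP cQ s (rinj r)       = rinj (sim-subV cP cQ s r)
    sim-subV cP cQ s (rΛ r)         = rΛ (sim-subT cP cQ (SimSub-Λ cP cQ s) r)

    sim-subT : ∀ {P Q σ σ' e e'} → ClosedInst P → ClosedInst Q → SimSub P Q σ σ' →
               SimT P e e' → SimT Q (subT σ e) (subT σ' e')
    sim-subT cP cQ s (rval r)       = rval (sim-subV cP cQ s r)
    sim-subT {σ = σ} {σ'} cP cQ s (rbase b ce ce') =
      subst₂ (SimT _) (sym (sub-fixed ce σ)) (sym (sub-fixed ce' σ')) (rbase b ce ce')
    sim-subT cP cQ s r？            = r？
    sim-subT cP cQ s (rfst r)       = rfst (sim-subV cP cQ s r)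
    sim-subT cP cQ s (rsnd r)       = rsnd (sim-subV cP cQ s r)
    sim-subT cP cQ s (rapp r q)     = rapp (sim-subV cP cQ s r) (sim-subT cP cQ s q)
    sim-subT cP cQ s (rcase r rs)   =
      rcase (sim-subV cP cQ s r) (sim-subTs (ClosedInst-lift cP) (ClosedInst-lift cQ) (SimSub-lift cP cQ s) rs)
    sim-subT cP cQ s (rtapp r)      = rtapp (sim-subV cP cQ s r)

    sim-subTs : ∀ {P Q σ σ' n} {bs bs' : Vec Tm n} → ClosedInst P → ClosedInst Q → SimSub P Q σ σ' →
                SimTs P bs bs' → SimTs Q (subTs σ bs) (subTs σ' bs')
    sim-subTs cP cQ s []       = []
    sim-subTs cP cQ s (r ∷ rs) = sim-subT cP cQ s r ∷ sim-subTs cP cQ s rs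

  sim-sub₀ : ∀ {P e e' a a'} → ClosedInst P → SimT (liftI P) e e' → SimV P a a' →
             SimT P (e [ a ]ᵉ) (e' [ a' ]ᵉ)
  sim-sub₀ c r q = sim-subT (ClosedInst-lift c) c
    (record { kept = λ { zero _ → q ; (suc x) p → rvar p } ; inst = λ { zero () ; (suc x) p → rinst p } }) r

  liftI-cong : ∀ {P Q} → (∀ x → P x ≡ Q x) → ∀ x → liftI P x ≡ liftI Q x
  liftI-cong h zero    = refl
  liftI-cong h (suc x) = h x

  mutual
    sim-respV : ∀ {P Q a a'} → (∀ x → P x ≡ Q x) → SimV P a a' → SimV Q a a'
    sim-respV h (rvar {x = x} p)  = rvar (trans (sym (h x)) p)
    sim-respV h (rinst {x = x} p) = rinst (trans (sym (h x)) p)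
    sim-respV h r⟨⟩               = r⟨⟩
    sim-respV h (rpair a b)       = rpair (sim-respV h a) (sim-respV h b)
    sim-respV h (rƛ r)            = rƛ (sim-respT (liftI-cong h) r)
    sim-respV h (rinj r)          = rinj (sim-respV h r)
    sim-respV h (rΛ r)            = rΛ (sim-respT h r)

    sim-respT : ∀ {P Q e e'} → (∀ x → P x ≡ Q x) → SimT P e e' → SimT Q e e'
    sim-respT h (rval r)          = rval (sim-respV h r)
    sim-respT h (rbase b ce ce')  = rbase b ce ce'
    sim-respT h r？               = r？
    sim-respT h (rfst r)          = rfst (sim-respV h r)
    sim-respT h (rsnd r)          = rsnd (sim-respV h r)
    sim-respT h (rapp r q)        = rapp (sim-respV h r) (sim-respT h q)
    sim-respT h (rcase r rs)      = rcase (sim-respV h r) (sim-respTs (liftI-cong h) rs)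
    sim-respT h (rtapp r)         = rtapp (sim-respV h r)

    sim-respTs : ∀ {P Q n} {bs bs' : Vec Tm n} → (∀ x → P x ≡ Q x) → SimTs P bs bs' → SimTs Q bs bs'
    sim-respTs h []       = []
    sim-respTs h (r ∷ rs) = sim-respT h r ∷ sim-respTs h rs

  liftI-empty : ∀ {P} → (∀ x → P x ≡ nothing) → ∀ x → liftI P x ≡ nothing
  liftI-empty h zero    = refl
  liftI-empty h (suc x) = h x

  mutual
    sim-reflV : ∀ {P} → (∀ x → P x ≡ nothing) → ∀ a → SimV P a a
    sim-reflV h (var x)   = rvar (h x)
    sim-reflV h ⟨⟩        = r⟨⟩
    sim-reflV h ⟨ a , b ⟩ = rpair (sim-reflV h a) (sim-reflV h b)
    sim-reflV h (ƛ e)     = rƛ (sim-reflT (liftI-empty h) e)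
    sim-reflV h (inj i a) = rinj (sim-reflV h a)
    sim-reflV h (Λ e)     = rΛ (sim-reflT h e)

    sim-reflT : ∀ {P} → (∀ x → P x ≡ nothing) → ∀ e → SimT P e e
    sim-reflT h (val v)     = rval (sim-reflV h v)
    sim-reflT h ？          = r？
    sim-reflT h (fst v)     = rfst (sim-reflV h v)
    sim-reflT h (snd v)     = rsnd (sim-reflV h v)
    sim-reflT h (v · e)     = rapp (sim-reflV h v) (sim-reflT h e)
    sim-reflT h (case v bs) = rcase (sim-reflV h v) (sim-reflTs (liftI-empty h) bs)
    sim-reflT h (tapp v s)  = rtapp (sim-reflV h v)

    sim-reflTs : ∀ {P n} → (∀ x → P x ≡ nothing) → (bs : Vec Tm n) → SimTs P bs bs
    sim-reflTs h []       = []
    sim-reflTs h (b ∷ bs) = sim-reflT h b ∷ sim-reflTs h bs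

  liftI-scope : ∀ {P n} → (∀ x → x < n → P x ≡ nothing) → ∀ x → x < suc n → liftI P x ≡ nothing
  liftI-scope h zero    p       = refl
  liftI-scope h (suc x) (s<s p) = h x p

  mutual
    sim-refl-typedV : ∀ {P Δ Γ v t} → Δ ⨾ Γ ⊢ val v ∶ t → (∀ x → x < length Γ → P x ≡ nothing) → SimV P v v
    sim-refl-typedV (⊢var p)     h = rvar (h _ (∋-bound p))
    sim-refl-typedV ⊢⟨⟩          h = r⟨⟩
    sim-refl-typedV (⊢pair a b)  h = rpair (sim-refl-typedV a h) (sim-refl-typedV b h)
    sim-refl-typedV (⊢ƛ w d)     h = rƛ (sim-refl-typedT d (liftI-scope h))
    sim-refl-typedV (⊢inj w i d) h = rinj (sim-refl-typedV d h)
    sim-refl-typedV {Γ = Γ} (⊢Λ d) h = rΛ (sim-refl-typedT d (λ x p → h x (<-length-map (renTy suc) Γ p)))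

    sim-refl-typedT : ∀ {P Δ Γ e t} → Δ ⨾ Γ ⊢ e ∶ t → (∀ x → x < length Γ → P x ≡ nothing) → SimT P e e
    sim-refl-typedT d@(⊢var _)     h = rval (sim-refl-typedV d h)
    sim-refl-typedT d@⊢⟨⟩          h = rval (sim-refl-typedV d h)
    sim-refl-typedT d@(⊢pair _ _)  h = rval (sim-refl-typedV d h)
    sim-refl-typedT d@(⊢ƛ _ _)     h = rval (sim-refl-typedV d h)
    sim-refl-typedT d@(⊢inj _ _ _) h = rval (sim-refl-typedV d h)
    sim-refl-typedT d@(⊢Λ _)       h = rval (sim-refl-typedV d h)
    sim-refl-typedT ⊢？            h = r？
    sim-refl-typedT (⊢fst d)       h = rfst (sim-refl-typedV d h)
    sim-refl-typedT (⊢snd d)       h = rsnd (sim-refl-typedV d h)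
    sim-refl-typedT (⊢app a b)     h = rapp (sim-refl-typedV a h) (sim-refl-typedT b h)
    sim-refl-typedT (⊢case {bs = bs} dv dbs) h =
      rcase (sim-refl-typedV dv h) (sims-tabulate bs bs (λ i → sim-refl-typedT (dbs i) (liftI-scope h)))
    sim-refl-typedT (⊢tapp d w)    h = rtapp (sim-refl-typedV d h)

  sim-num : ∀ {P} n → SimV P (num n) (num n)
  sim-num zero    = rinj r⟨⟩
  sim-num (suc n) = rinj (sim-num n)

  data BackStep (P : Inst) (X Y' : Tm) : Set where
    matched : ∀ {X'} → X ⟶ X' → SimT P X' Y' → BackStep P X Y'
    base    : Base X → BackStep P X Y'
    stuck   : Stuck P X → BackStep P X Y'

  module Backward (base-arg : ∀ {v e} → Base e → Base (v · e)) where

    sim-backward : ∀ {P X Y Y'} → ClosedInst P → SimT P X Y → Y ⟶ Y' → BackStep P X Y'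
    sim-backward c (rbase b _ _)             s          = base b
    sim-backward c r？                       (β-？ n)    = matched (β-？ n) (rval (sim-num n))
    sim-backward c (rfst (rpair a b))        β-fst      = matched β-fst (rval a)
    sim-backward c (rfst (rinst p))          β-fst      = stuck (stuck-fst p)
    sim-backward c (rsnd (rpair a b))        β-snd      = matched β-snd (rval b)
    sim-backward c (rsnd (rinst p))          β-snd      = stuck (stuck-snd p)
    sim-backward c (rapp (rinst p) q)        β-ƛ        = stuck (stuck-app p)
    sim-backward c (rapp (rƛ r) (rval q))    β-ƛ        = matched β-ƛ (sim-sub₀ c r q)
    sim-backward c (rapp (rƛ r) (rbase b _ _)) β-ƛ      = base (base-arg b)
    sim-backward c (rapp r q)                (ξ-app s) with sim-backward c q s
    ... | matched s' q' = matched (ξ-app s') (rapp r q')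
    ... | base b        = base (base-arg b)
    ... | stuck st      = stuck (stuck-arg st)
    sim-backward c (rcase (rinj r) rs)       (β-case j) = matched (β-case j) (sim-sub₀ c (sims-lookup rs j) r)
    sim-backward c (rcase (rinst p) rs)      (β-case j) = stuck (stuck-case p)
    sim-backward c (rtapp (rΛ r))            β-Λ        = matched β-Λ (sim-tysubT c r)
    sim-backward c (rtapp (rinst p))         β-Λ        = stuck (stuck-tapp p)

  module Forward (no-base : ∀ {e} → ¬ Base e) where

    sim-forward : ∀ {P X X' Y} → ClosedInst P → SimT P X Y → X ⟶ X' → Σ Tm λ Y' → (Y ⟶ Y') × SimT P X' Y'
    sim-forward c (rbase b _ _)               s          = ⊥-elim (no-base b)
    sim-forward c r？                         (β-？ n)    = _ , β-？ n , rval (sim-num n)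
    sim-forward c (rfst (rpair a b))          β-fst      = _ , β-fst , rval a
    sim-forward c (rsnd (rpair a b))          β-snd      = _ , β-snd , rval b
    sim-forward c (rapp (rƛ r) (rval q))      β-ƛ        = _ , β-ƛ , sim-sub₀ c r q
    sim-forward c (rapp (rƛ r) (rbase b _ _)) β-ƛ        = ⊥-elim (no-base b)
    sim-forward c (rapp r q)                  (ξ-app s) with sim-forward c q s
    ... | Y' , s' , q' = _ , ξ-app s' , rapp r q'
    sim-forward c (rcase (rinj r) rs)         (β-case j) = _ , β-case j , sim-sub₀ c (sims-lookup rs j) r
    sim-forward c (rtapp (rΛ r))              β-Λ        = _ , β-Λ , sim-tysubT c r

module Uniformity where
  open Simulation (λ _ → ⊥)
  open Backward (λ ())
  open Forward (λ ())

  data IsTyVar : Ty → Set where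
    tyvar : ∀ α → IsTyVar (tv α)

  AbstractInst : Ctx → Inst → Set
  AbstractInst Γ P = ∀ {x t U} → P x ≡ just U → Γ ∋ x ∶ t → IsTyVar t

  -- A term cannot eliminate a variable of abstract type, so a well-typed
  -- term is never stuck on an abstractly typed variable.
  stuck-ill-typed : ∀ {P Δ Γ X t} → AbstractInst Γ P → Stuck P X → ¬ (Δ ⨾ Γ ⊢ X ∶ t)
  stuck-ill-typed abs (stuck-fst p)  (⊢fst (⊢var q))   with abs p q
  ... | ()
  stuck-ill-typed abs (stuck-snd p)  (⊢snd (⊢var q))   with abs p q
  ... | ()
  stuck-ill-typed abs (stuck-app p)  (⊢app (⊢var q) _) with abs p q
  ... | ()
  stuck-ill-typed abs (stuck-case p) (⊢case (⊢var q) _) with abs p q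
  ... | ()
  stuck-ill-typed abs (stuck-tapp p) (⊢tapp (⊢var q) _) with abs p q
  ... | ()
  stuck-ill-typed abs (stuck-arg st) (⊢app _ d)        = stuck-ill-typed abs st d

  -- If one instance of a well-typed open term G, whose instantiated variables
  -- have abstract type, diverges, then every other instance diverges: each
  -- step of the divergent run is matched by a step of G (backward simulation;
  -- G cannot be stuck), which is matched by the other instance (forward
  -- simulation).  The state pairs G with the run index and the other instance.
  transfer-divergence : ∀ {P₁ P₂ Δ Γ G t X Y} → ClosedInst P₁ → ClosedInst P₂ → AbstractInst Γ P₁ →
                        Δ ⨾ Γ ⊢ G ∶ t → SimT P₁ G X → SimT P₂ G Y → MayDiverge X → MayDiverge Y
  transfer-divergence {P₁} {P₂} {Δ} {Γ} {G} {t} {Y = Y} c₁ c₂ abs ⊢G G~X G~Y (run , refl , run-steps) =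
    diverge-by-unfolding current step (0 , G , Y , ⊢G , G~X , G~Y)
    where
      State : Set
      State = Σ ℕ λ n → Σ Tm λ G → Σ Tm λ Y → (Δ ⨾ Γ ⊢ G ∶ t) × SimT P₁ G (run n) × SimT P₂ G Y

      current : State → Tm
      current (_ , _ , Y , _) = Y

      step : ∀ s → Σ State λ s' → current s ⟶ current s'
      step (n , G , Y , ⊢G , G~X , G~Y) with sim-backward c₁ G~X (run-steps n)
      ... | base ()
      ... | stuck st = ⊥-elim (stuck-ill-typed abs st ⊢G)
      ... | matched G⟶G' G'~X' with sim-forward c₂ G~Y G⟶G'
      ... | Y' , Y⟶Y' , G'~Y' = (suc n , _ , Y' , preservation G⟶G' ⊢G , G'~X' , G'~Y') , Y⟶Y'

  pair-inst : Val → Val → Inst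
  pair-inst u₁ u₂ zero          = just u₁
  pair-inst u₁ u₂ (suc zero)    = just u₂
  pair-inst u₁ u₂ (suc (suc x)) = nothing

  pair-inst-closed : ∀ {u₁ u₂ t₁ t₂} → IsVal t₁ u₁ → IsVal t₂ u₂ → ClosedInst (pair-inst u₁ u₂)
  pair-inst-closed ⊢u₁ ⊢u₂ = record { closed = λ { zero refl → closed-typed ⊢u₁
                                                  ; (suc zero) refl → closed-typed ⊢u₂ } }

  pair-inst-abstract : ∀ {u₁ u₂} → AbstractInst (tv 0 ∷ tv 0 ∷ []) (pair-inst u₁ u₂)
  pair-inst-abstract _ here         = tyvar 0
  pair-inst-abstract _ (there here) = tyvar 0

  -- Lemma: whether (λx. x u)(v[τ]) diverges does not depend on τ or u.  All
  -- these terms are instances of the generic (λx. x ⟨y₁ , y₂⟩)(v[α]) in the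
  -- context y₁ y₂ : α.
  divergence-uniform : ∀ {v τ τ' u u'} → IsVal (∀ᵗ (tv 0 ⊗ tv 0 ⇒ tv 0)) v → IsVal (τ ⊗ τ) u → IsVal (τ' ⊗ τ') u' →
                       MayDiverge (ƛ (var 0 · val u) · tapp v τ) → MayDiverge (ƛ (var 0 · val u') · tapp v τ')
  divergence-uniform {v} ⊢v (⊢pair ⊢u₁ ⊢u₂) (⊢pair ⊢u₁' ⊢u₂') =
    transfer-divergence (pair-inst-closed ⊢u₁ ⊢u₂) (pair-inst-closed ⊢u₁' ⊢u₂') pair-inst-abstract
      ⊢generic instance-of-generic instance-of-generic
    where
      generic : Tm
      generic = ƛ (var 0 · val ⟨ var 1 , var 2 ⟩) · tapp v (tv 0)

      ⊢generic : 1 ⨾ tv 0 ∷ tv 0 ∷ [] ⊢ generic ∶ tv 0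
      ⊢generic = ⊢app (⊢ƛ (wf-⇒ (wf-⊗ (wf-tv z<s) (wf-tv z<s)) (wf-tv z<s))
                          (⊢app (⊢var here) (⊢pair (⊢var (there here)) (⊢var (there (there here))))))
                      (⊢tapp (⊢-weaken-closed ⊢v) (wf-tv z<s))

      instance-of-generic : ∀ {u₁ u₂ τ} → SimT (pair-inst u₁ u₂) generic (ƛ (var 0 · val ⟨ u₁ , u₂ ⟩) · tapp v τ)
      instance-of-generic = rapp (rƛ (rapp (rvar refl) (rval (rpair (rinst refl) (rinst refl)))))
                                 (rtapp (sim-refl-typedV ⊢v (λ _ ())))

open Uniformity using (divergence-uniform)

-- Diverging terms are contextually least.  The relation Below relates
-- well-typed terms connected by a chain of one-step approximations
-- SimT ∅ (Base = divergence, no instantiated variables).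

module Approximation where
  open Simulation MayDiverge
  open Backward diverge-arg

  ∅ : Inst
  ∅ _ = nothing

  ∅-empty : ∀ x → ∅ x ≡ nothing
  ∅-empty _ = refl

  ∅-lift : ∀ x → ∅ x ≡ liftI ∅ x
  ∅-lift zero    = refl
  ∅-lift (suc x) = refl

  ∅-closed : ClosedInst ∅
  ∅-closed = record { closed = λ _ () }

  ∅-never-stuck : ∀ {X} → ¬ Stuck ∅ X
  ∅-never-stuck (stuck-fst ())
  ∅-never-stuck (stuck-snd ())
  ∅-never-stuck (stuck-app ())
  ∅-never-stuck (stuck-case ())
  ∅-never-stuck (stuck-tapp ())
  ∅-never-stuck (stuck-arg st) = ∅-never-stuck st

  -- Divergence of the right-hand side is reflected on the left: follow the
  -- right-hand run by backward simulation until the left-hand term is found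
  -- to diverge itself, and from then on follow its own divergent run.
  approx-reflects-divergence : ∀ {X Y} → SimT ∅ X Y → MayDiverge Y → MayDiverge X
  approx-reflects-divergence {X} X~Y (run , refl , run-steps) = diverge-by-unfolding current step (inj₁ (0 , X , X~Y))
    where
      State : Set
      State = (Σ ℕ λ n → Σ Tm λ X → SimT ∅ X (run n)) ⊎ (Σ Tm MayDiverge)

      current : State → Tm
      current (inj₁ (_ , X , _)) = X
      current (inj₂ (X , _))     = X

      diverging : ∀ {X} → MayDiverge X → Σ State λ s' → X ⟶ current s'
      diverging div with diverge-step div
      ... | X' , X⟶X' , div' = inj₂ (X' , div') , X⟶X'

      step : ∀ s → Σ State λ s' → current s ⟶ current s'
      step (inj₁ (n , X , X~Y)) with sim-backward ∅-closed X~Y (run-steps n)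
      ... | matched X⟶X' X'~Y' = inj₁ (suc n , _ , X'~Y') , X⟶X'
      ... | base div           = diverging div
      ... | stuck st           = ⊥-elim (∅-never-stuck st)
      step (inj₂ (X , div))    = diverging div

  approx*-reflects-divergence : ∀ {X Y} → Star (SimT ∅) X Y → MayDiverge Y → MayDiverge X
  approx*-reflects-divergence ε         div = div
  approx*-reflects-divergence (r ◅ rs) div = approx-reflects-divergence r (approx*-reflects-divergence rs div)

  -- A chain between values is a chain of value approximations, since
  -- values do not diverge.
  value-chain : ∀ {a b} → Star (SimT ∅) (val a) (val b) → Star (SimV ∅) a b
  value-chain ε                      = ε
  value-chain (rval r ◅ rs)          = r ◅ value-chain rs
  value-chain (rbase div _ _ ◅ rs)   = ⊥-elim (value-converges div)

  branches-chain : ∀ {n} (bs bs' : Vec Tm n) → (∀ i → Star (SimT ∅) (lookup bs i) (lookup bs' i)) →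
                   Star (SimTs (liftI ∅)) bs bs'
  branches-chain []       []         h = ε
  branches-chain (b ∷ bs) (b' ∷ bs') h =
    gmap (_∷ bs) (λ r → sim-respT ∅-lift r ∷ sim-reflTs (liftI-empty ∅-empty) bs) (h zero) ◅◅
    gmap (b' ∷_) (λ rs → sim-reflT (liftI-empty ∅-empty) b' ∷ rs) (branches-chain bs bs' (h ∘ suc))

  Below : TRel
  Below Δ Γ e e' t = (Δ ⨾ Γ ⊢ e ∶ t) × (Δ ⨾ Γ ⊢ e' ∶ t) × Star (SimT ∅) e e'

  Below-compatible : Compatible Below
  Below-compatible = record
    { c-var  = λ p → ⊢var p , ⊢var p , ε
    ; c-⟨⟩   = ⊢⟨⟩ , ⊢⟨⟩ , ε
    ; c-？    = ⊢？ , ⊢？ , ε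
    ; c-pair = λ { {v₁' = v₁'} {v₂ = v₂} (d₁ , d₁' , p₁) (d₂ , d₂' , p₂) → ⊢pair d₁ d₂ , ⊢pair d₁' d₂' ,
        (gmap (λ x → val ⟨ x , v₂ ⟩) (λ r → rval (rpair r (sim-reflV ∅-empty v₂))) (value-chain p₁) ◅◅
         gmap (λ y → val ⟨ v₁' , y ⟩) (λ r → rval (rpair (sim-reflV ∅-empty v₁') r)) (value-chain p₂)) }
    ; c-ƛ    = λ w (d , d' , p) → ⊢ƛ w d , ⊢ƛ w d' , gmap (val ∘ ƛ) (λ r → rval (rƛ (sim-respT ∅-lift r))) p
    ; c-inj  = λ w i (d , d' , p) → ⊢inj w i d , ⊢inj w i d' ,
        gmap (val ∘ inj (toℕ i)) (λ r → rval (rinj r)) (value-chain p)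
    ; c-Λ    = λ (d , d' , p) → ⊢Λ d , ⊢Λ d' , gmap (val ∘ Λ) (λ r → rval (rΛ r)) p
    ; c-fst  = λ (d , d' , p) → ⊢fst d , ⊢fst d' , gmap fst rfst (value-chain p)
    ; c-snd  = λ (d , d' , p) → ⊢snd d , ⊢snd d' , gmap snd rsnd (value-chain p)
    ; c-app  = λ { {v' = v'} {e = e} (d₁ , d₁' , p₁) (d₂ , d₂' , p₂) → ⊢app d₁ d₂ , ⊢app d₁' d₂' ,
        (gmap (_· e) (λ r → rapp r (sim-reflT ∅-empty e)) (value-chain p₁) ◅◅
         gmap (v' ·_) (rapp (sim-reflV ∅-empty v')) p₂) }
    ; c-case = λ { {v' = v'} {bs = bs} {bs'} (d , d' , p) h →
        ⊢case d (proj₁ ∘ h) , ⊢case d' (proj₁ ∘ proj₂ ∘ h) ,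
        (gmap (λ a → case a bs) (λ r → rcase r (sim-reflTs (liftI-empty ∅-empty) bs)) (value-chain p) ◅◅
         gmap (case v') (rcase (sim-reflV ∅-empty v')) (branches-chain bs bs' (proj₂ ∘ proj₂ ∘ h))) }
    ; c-tapp = λ { {σ = s} (d , d' , p) w → ⊢tapp d w , ⊢tapp d' w , gmap (λ a → tapp a s) rtapp (value-chain p) }
    }

  Below-precongruence : Precongruence Below
  Below-precongruence =
    (λ d → d , d , ε) ,
    (λ { (d , _ , p) (_ , d' , q) → d , d' , p ◅◅ q }) ,
    Below-compatible

  Below-adequate : MustAdequate Below
  Below-adequate (_ , _ , p) e⇓ div = e⇓ (approx*-reflects-divergence p div)

  -- Lemma: a diverging closed term is contextually below every closed term
  -- of its type (one approximation step by the base case suffices).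
  diverging-below : ∀ {e e' t} → 0 ⨾ [] ⊢ e ∶ t → 0 ⨾ [] ⊢ e' ∶ t → MayDiverge e → 0 ⨾ [] ⊢ e ≲ctx e' ∶ t
  diverging-below d d' div =
    Below , (λ (d , d' , _) → d , d') , Below-precongruence , Below-adequate ,
    (d , d' , rbase div (closed-typed d) (closed-typed d') ◅ ε)

open Approximation using (diverging-below)

-- Lemma 6.3.  The instance (λx. x u')(v[τ']) diverges, by uniformity from
-- the divergent instance at (τ, u), and so does Ω[τ']; a diverging term is
-- below every term of its type, which gives both directions.
lemma6p3 : (v : Val) → IsVal (∀ᵗ (tv 0 ⊗ tv 0 ⇒ tv 0)) v →
    (∀ τ → Closed τ → tapp v τ ⇓) →
    (Σ Ty λ τ → Closed τ × Σ Val λ u → IsVal (τ ⊗ τ) u ×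
      MayDiverge (ƛ (var 0 · val u) · tapp v τ)) →
    ∀ τ' → Closed τ' → ∀ u' → IsVal (τ' ⊗ τ') u' →
    0 ⨾ [] ⊢ ƛ (var 0 · val u') · tapp v τ' ≅ctx tapp Ω τ' ∶ τ'
lemma6p3 v ⊢v _ (τ , _ , u , ⊢u , diverges) τ' wf-τ' u' ⊢u' =
  diverging-below ⊢instance ⊢Ω[τ'] (divergence-uniform ⊢v ⊢u ⊢u' diverges) ,
  diverging-below ⊢Ω[τ'] ⊢instance (Ω-diverges τ')
  where
    ⊢instance : 0 ⨾ [] ⊢ ƛ (var 0 · val u') · tapp v τ' ∶ τ'
    ⊢instance = ⊢app (⊢ƛ (wf-⇒ (wf-⊗ wf-τ' wf-τ') wf-τ') (⊢app (⊢var here) (⊢-weaken-closed ⊢u')))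
                     (⊢tapp ⊢v wf-τ')

    ⊢Ω[τ'] : 0 ⨾ [] ⊢ tapp Ω τ' ∶ τ'
    ⊢Ω[τ'] = ⊢tapp ⊢Ω wf-τ'
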